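{- Let $\mathcal{T}$ be the set of all trees obtained from the path $P_3$ (on three vertices) by repeated (zero or more) applications of the following two operations to a tree $G'$ already obtained: $(O_1)$: add three new vertices $u,v,w$ with edges $uv$ and $vw$, and add one edge between $w$ and some vertex of $G'$; $(O_2)$: add three new vertices $u,u',v$ with edges $uv$ and $u'v$, and add one edge between $v$ and some vertex of $G'$. Then for every tree $T$ of order $n$ the following statements are equivalent: (a) $\mathrm{diss}(T)=\frac{2n}{3}$; (b) $T\in\mathcal{T}$; (c) $n\equiv 0 \pmod 3$, and for every vertex $y$ of $T$, at most two components of $T-y$ have order not congruent to $0$ modulo $3$.
   Context: A set $D$ of vertices of a graph $G$ is a dissociation set if the induced subgraph $G[D]$ has maximum degree at most $1$; $\mathrm{diss}(G)$ is the maximum order of a dissociation set in $G$. All graphs are finite, simple, and undirected. -}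

module Defs where

open import Data.Nat using (ℕ; zero; suc; _+_; _*_; _≤_)
open import Data.Nat.Divisibility using (_∣_)
open import Data.Bool using (Bool; true; false; T; _∨_)
open import Data.Fin using (Fin; zero; suc; inject₁; fromℕ; _≟_)
open import Data.Fin.Subset using (Subset; _∈_; _∉_; _∩_; ∣_∣)
open import Data.Vec using (tabulate)
open import Data.List using (List; length)
open import Data.List.Relation.Unary.All using (All)
open import Data.List.Relation.Unary.AllPairs using (AllPairs)
open import Data.Product using (Σ; ∃; _×_)
open import Relation.Binary.PropositionalEquality using (_≡_; _≢_)
open import Relation.Nullary using (¬_; does)
open import Function.Bundles using (_↔_; Inverse; _⇔_)
open import Function.Definitions using (Injective)

record Graph (n : ℕ) : Set where
  field
    adj    : Fin n → Fin n → Bool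
    sym    : ∀ u v → adj u v ≡ adj v u
    irrefl : ∀ v → adj v v ≡ false

open Graph public

Adj : ∀ {n} → Graph n → Fin n → Fin n → Set
Adj G u v = T (adj G u v)

data Walk {n} (G : Graph n) : Fin n → Fin n → Set where
  here : ∀ {a} → Walk G a a
  step : ∀ {a b c} → Adj G a b → Walk G b c → Walk G a c

Connected : ∀ {n} → Graph n → Set
Connected {n} G = ∀ (u v : Fin n) → Walk G u v

record Cycle {n} (G : Graph n) : Set where
  field
    m     : ℕ
    vtx   : Fin (3 + m) → Fin n
    inj   : Injective _≡_ _≡_ vtx
    edges : ∀ (i : Fin (2 + m)) → Adj G (vtx (inject₁ i)) (vtx (suc i))
    close : Adj G (vtx (fromℕ (2 + m))) (vtx zero)

Acyclic : ∀ {n} → Graph n → Set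
Acyclic G = ¬ Cycle G

record IsTree {n} (G : Graph n) : Set where
  field
    nonempty  : 1 ≤ n
    connected : Connected G
    acyclic   : Acyclic G

nbhd : ∀ {n} → Graph n → Fin n → Subset n
nbhd G v = tabulate (adj G v)

-- G[D] has maximum degree at most 1
IsDissociation : ∀ {n} → Graph n → Subset n → Set
IsDissociation G D = ∀ v → v ∈ D → ∣ D ∩ nbhd G v ∣ ≤ 1

IsDissNumber : ∀ {n} → Graph n → ℕ → Set
IsDissNumber {n} G k =
  (Σ (Subset n) λ D → IsDissociation G D × ∣ D ∣ ≡ k) ×
  (∀ (D : Subset n) → IsDissociation G D → ∣ D ∣ ≤ k)

record _≅_ {n m} (G : Graph n) (H : Graph m) : Set where
  field
    bij  : Fin n ↔ Fin m
    pres : ∀ u v → adj G u v ≡ adj H (Inverse.to bij u) (Inverse.to bij v)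

p3adj : Fin 3 → Fin 3 → Bool
p3adj zero (suc zero) = true
p3adj (suc zero) zero = true
p3adj (suc zero) (suc (suc zero)) = true
p3adj (suc (suc zero)) (suc zero) = true
p3adj _ _ = false

P3 : Graph 3
P3 = record { adj = p3adj ; sym = s ; irrefl = i }
  where
  s : ∀ u v → p3adj u v ≡ p3adj v u
  s zero zero = _≡_.refl
  s zero (suc zero) = _≡_.refl
  s zero (suc (suc zero)) = _≡_.refl
  s (suc zero) zero = _≡_.refl
  s (suc zero) (suc zero) = _≡_.refl
  s (suc zero) (suc (suc zero)) = _≡_.refl
  s (suc (suc zero)) zero = _≡_.refl
  s (suc (suc zero)) (suc zero) = _≡_.refl
  s (suc (suc zero)) (suc (suc zero)) = _≡_.refl
  i : ∀ v → p3adj v v ≡ false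
  i zero = _≡_.refl
  i (suc zero) = _≡_.refl
  i (suc (suc zero)) = _≡_.refl

-- In the extended graph on Fin (3 + n), the new vertices are
-- 0, 1, 2 and the old vertex i of G' is suc (suc (suc i)).
isV : ∀ {n} → Fin n → Fin n → Bool
isV x y = does (x ≟ y)

-- O1: new u = 0, v = 1, w = 2; edges uv, vw, and w x
o1adj : ∀ {n} → Graph n → Fin n → Fin (3 + n) → Fin (3 + n) → Bool
o1adj G x zero (suc zero) = true
o1adj G x (suc zero) zero = true
o1adj G x (suc zero) (suc (suc zero)) = true
o1adj G x (suc (suc zero)) (suc zero) = true
o1adj G x (suc (suc zero)) (suc (suc (suc j))) = isV x j
o1adj G x (suc (suc (suc i))) (suc (suc zero)) = isV x i
o1adj G x (suc (suc (suc i))) (suc (suc (suc j))) = adj G i j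
o1adj G x _ _ = false

-- O2: new u = 0, u' = 1, v = 2; edges uv, u'v, and v x
o2adj : ∀ {n} → Graph n → Fin n → Fin (3 + n) → Fin (3 + n) → Bool
o2adj G x zero (suc (suc zero)) = true
o2adj G x (suc (suc zero)) zero = true
o2adj G x (suc zero) (suc (suc zero)) = true
o2adj G x (suc (suc zero)) (suc zero) = true
o2adj G x (suc (suc zero)) (suc (suc (suc j))) = isV x j
o2adj G x (suc (suc (suc i))) (suc (suc zero)) = isV x i
o2adj G x (suc (suc (suc i))) (suc (suc (suc j))) = adj G i j
o2adj G x _ _ = false


o1-sym : ∀ {n} (G : Graph n) x u v → o1adj G x u v ≡ o1adj G x v u
o1-sym G x zero zero = _≡_.refl
o1-sym G x zero (suc zero) = _≡_.refl
o1-sym G x zero (suc (suc zero)) = _≡_.refl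
o1-sym G x zero (suc (suc (suc j))) = _≡_.refl
o1-sym G x (suc zero) zero = _≡_.refl
o1-sym G x (suc zero) (suc zero) = _≡_.refl
o1-sym G x (suc zero) (suc (suc zero)) = _≡_.refl
o1-sym G x (suc zero) (suc (suc (suc j))) = _≡_.refl
o1-sym G x (suc (suc zero)) zero = _≡_.refl
o1-sym G x (suc (suc zero)) (suc zero) = _≡_.refl
o1-sym G x (suc (suc zero)) (suc (suc zero)) = _≡_.refl
o1-sym G x (suc (suc zero)) (suc (suc (suc j))) = _≡_.refl
o1-sym G x (suc (suc (suc i))) zero = _≡_.refl
o1-sym G x (suc (suc (suc i))) (suc zero) = _≡_.refl
o1-sym G x (suc (suc (suc i))) (suc (suc zero)) = _≡_.refl
o1-sym G x (suc (suc (suc i))) (suc (suc (suc j))) = sym G i j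

o1-irr : ∀ {n} (G : Graph n) x v → o1adj G x v v ≡ false
o1-irr G x zero = _≡_.refl
o1-irr G x (suc zero) = _≡_.refl
o1-irr G x (suc (suc zero)) = _≡_.refl
o1-irr G x (suc (suc (suc i))) = irrefl G i

O1 : ∀ {n} → Graph n → Fin n → Graph (3 + n)
O1 G x = record { adj = o1adj G x ; sym = o1-sym G x ; irrefl = o1-irr G x }

o2-sym : ∀ {n} (G : Graph n) x u v → o2adj G x u v ≡ o2adj G x v u
o2-sym G x zero zero = _≡_.refl
o2-sym G x zero (suc zero) = _≡_.refl
o2-sym G x zero (suc (suc zero)) = _≡_.refl
o2-sym G x zero (suc (suc (suc j))) = _≡_.refl
o2-sym G x (suc zero) zero = _≡_.refl
o2-sym G x (suc zero) (suc zero) = _≡_.refl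
o2-sym G x (suc zero) (suc (suc zero)) = _≡_.refl
o2-sym G x (suc zero) (suc (suc (suc j))) = _≡_.refl
o2-sym G x (suc (suc zero)) zero = _≡_.refl
o2-sym G x (suc (suc zero)) (suc zero) = _≡_.refl
o2-sym G x (suc (suc zero)) (suc (suc zero)) = _≡_.refl
o2-sym G x (suc (suc zero)) (suc (suc (suc j))) = _≡_.refl
o2-sym G x (suc (suc (suc i))) zero = _≡_.refl
o2-sym G x (suc (suc (suc i))) (suc zero) = _≡_.refl
o2-sym G x (suc (suc (suc i))) (suc (suc zero)) = _≡_.refl
o2-sym G x (suc (suc (suc i))) (suc (suc (suc j))) = sym G i j

o2-irr : ∀ {n} (G : Graph n) x v → o2adj G x v v ≡ false
o2-irr G x zero = _≡_.refl
o2-irr G x (suc zero) = _≡_.refl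
o2-irr G x (suc (suc zero)) = _≡_.refl
o2-irr G x (suc (suc (suc i))) = irrefl G i

O2 : ∀ {n} → Graph n → Fin n → Graph (3 + n)
O2 G x = record { adj = o2adj G x ; sym = o2-sym G x ; irrefl = o2-irr G x }

-- 𝒯: generated from P3 by O1 and O2 (trees considered up to isomorphism)
data InT : ∀ {n} → Graph n → Set where
  base : InT P3
  op1  : ∀ {n} {G : Graph n} → InT G → (x : Fin n) → InT (O1 G x)
  op2  : ∀ {n} {G : Graph n} → InT G → (x : Fin n) → InT (O2 G x)
  iso  : ∀ {n m} {G : Graph n} {H : Graph m} → InT G → G ≅ H → InT H

data WalkAvoid {n} (G : Graph n) (y : Fin n) : Fin n → Fin n → Set where
  here : ∀ {a} → a ≢ y → WalkAvoid G y a a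
  step : ∀ {a b c} → a ≢ y → Adj G a b → WalkAvoid G y b c → WalkAvoid G y a c

IsComponentMinus : ∀ {n} → Graph n → Fin n → Subset n → Set
IsComponentMinus {n} G y C =
  (∃ λ a → a ∈ C) × y ∉ C ×
  (∀ (a b : Fin n) → a ∈ C → (b ∈ C ⇔ WalkAvoid G y a b))

AtMostTwoBadComponents : ∀ {n} → Graph n → Fin n → Set
AtMostTwoBadComponents {n} G y =
  ∀ (Cs : List (Subset n)) → AllPairs _≢_ Cs →
  All (λ C → IsComponentMinus G y C × ¬ (3 ∣ ∣ C ∣)) Cs →
  length Cs ≤ 2

{-# OPTIONS --safe #-}

-- Call the components of T - y the branches at y, and a branch bad if its order
-- is not divisible by 3.
--
-- (b ⇒ a) Each operation adds three vertices of which a dissociation set contains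
-- at most two, while two of them can always be added, so diss = 2n/3 is preserved.
--
-- (a ⇒ c) Dissociation sets are built bottom-up along the branches: a branch of
-- order s carries one of order at least 2s/3, with sharper variants according to
-- s mod 3 and to whether its root is used.  At a vertex y the union over all
-- branches, with each bound rounded up to an integer, gains the residue of every
-- bad branch, so three bad branches at y give a dissociation set larger than 2n/3.
--
-- (c ⇒ b) If 3 ∣ n and no vertex has three bad branches, descending through
-- branches of order ≡ 0 (mod 3) reaches a branch of order exactly 3.  It is a path
-- attached at an end or at its centre; deleting it preserves (c), and T arises from
-- the smaller tree by O1 or O2.

module Submission where

open import Defs hiding (sym)
open import Data.Nat using (ℕ; zero; suc; _+_; _*_; _≤_; _<_; z≤n; s≤s; _∸_; _≤?_; _≡ᵇ_) renaming (_≟_ to _≟ℕ_)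
open import Data.Nat.Properties hiding (_≟_)
open import Data.Bool using (Bool; true; false; T; _∧_; _∨_; not; if_then_else_)
open import Data.Bool.Properties using (∧-zeroʳ; ∧-identityʳ)
open import Data.Fin using (Fin; zero; suc; _≟_; inject₁; fromℕ)
open import Data.Fin.Subset using (Subset; _∈_; _∩_; ∣_∣)
open import Data.Vec using ([]; _∷_; lookup; tabulate)
open import Data.Vec.Properties using ([]=⇒lookup; lookup⇒[]=; lookup-zipWith; lookup∘tabulate; tabulate∘lookup; tabulate-cong)
open import Data.Product using (∃; ∃₂; _×_; _,_; proj₁; proj₂; Σ)
open import Data.Sum using (_⊎_; inj₁; inj₂; [_,_]′)
open import Data.Empty using (⊥-elim; ⊥)
open import Data.Unit using (tt)
open import Data.List using (List; []; _∷_; length)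
open import Data.List.Relation.Unary.All using (All; []; _∷_)
open import Data.List.Relation.Unary.AllPairs using (AllPairs; []; _∷_)
open import Relation.Binary.PropositionalEquality
open import Relation.Nullary using (¬_; yes; no; does; isYes; contradiction; Dec)
open import Relation.Nullary.Decidable using (T?; toWitness; fromWitness; _×-dec_)
open import Data.Fin.Properties using (any?)
open import Algebra.Properties.CommutativeMonoid.Sum +-0-commutativeMonoid using (sum; sum-cong-≗; sum-permute; ∑-comm; ∑-distrib-+)
open import Data.Nat.Divisibility using (_∣_; divides)
open import Function.Bundles using (_⇔_; mk⇔; Equivalence; _↔_; Inverse)
open import Data.Fin.Permutation using (↔⇒≡; Permutation; transpose; _∘ₚ_; _⟨$⟩ʳ_; _⟨$⟩ˡ_; inverseˡ; inverseʳ)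
open import Data.Fin.Patterns using (0F; 1F; 2F)
open import Function using (_∘_)

T∧ : ∀ {a b} → T a → T b → T (a ∧ b)
T∧ {true} {true} _ _ = tt

T∧₁ : ∀ {a b} → T (a ∧ b) → T a
T∧₁ {true} _ = tt

T∧₂ : ∀ {a b} → T (a ∧ b) → T b
T∧₂ {true} {true} _ = tt

T∨₁ : ∀ {a b} → T a → T (a ∨ b)
T∨₁ {true} _ = tt

T∨₂ : ∀ {a b} → T b → T (a ∨ b)
T∨₂ {true} _ = tt
T∨₂ {false} t = t

T∨-elim : ∀ {a b} → T (a ∨ b) → T a ⊎ T b
T∨-elim {true} _ = inj₁ tt
T∨-elim {false} t = inj₂ t

T-not : ∀ {a} → ¬ T a → T (not a)
T-not {true} h = h tt
T-not {false} _ = tt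

T-not⁻ : ∀ {a} → T (not a) → ¬ T a
T-not⁻ {true} () _

T⇒≡true : ∀ {b} → T b → b ≡ true
T⇒≡true {true} _ = refl

≡true⇒T : ∀ {b} → b ≡ true → T b
≡true⇒T refl = tt

¬T⇒≡false : ∀ {b} → ¬ T b → b ≡ false
¬T⇒≡false {true} h = ⊥-elim (h tt)
¬T⇒≡false {false} _ = refl

≡false⇒¬T : ∀ {b} → b ≡ false → ¬ T b
≡false⇒¬T refl ()

T-ext : ∀ {a b} → (T a → T b) → (T b → T a) → a ≡ b
T-ext {true} {true} _ _ = refl
T-ext {true} {false} f _ = ⊥-elim (f tt)
T-ext {false} {true} _ g = ⊥-elim (g tt)
T-ext {false} {false} _ _ = refl

_==_ : ∀ {n} → Fin n → Fin n → Bool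
a == b = does (a ≟ b)

==-refl : ∀ {n} (a : Fin n) → (a == a) ≡ true
==-refl a with a ≟ a
... | yes _ = refl
... | no ne = ⊥-elim (ne refl)

==-≢ : ∀ {n} {a b : Fin n} → a ≢ b → (a == b) ≡ false
==-≢ {a = a} {b} ne with a ≟ b
... | yes e = ⊥-elim (ne e)
... | no _ = refl

T-==⇒≡ : ∀ {n} {a b : Fin n} → T (a == b) → a ≡ b
T-==⇒≡ {a = a} {b} t with a ≟ b
... | yes e = e

χ : Bool → ℕ
χ true = 1
χ false = 0

χ≡1 : ∀ {b} → T b → χ b ≡ 1
χ≡1 {true} _ = refl

χ≡0 : ∀ {b} → ¬ T b → χ b ≡ 0
χ≡0 {true} h = ⊥-elim (h tt)
χ≡0 {false} _ = refl

1≤χ⇒T : ∀ {b} → 1 ≤ χ b → T b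
1≤χ⇒T {true} _ = tt

χ-∨ : ∀ a b → ¬ (T a × T b) → χ (a ∨ b) ≡ χ a + χ b
χ-∨ true true h = ⊥-elim (h (tt , tt))
χ-∨ true false h = refl
χ-∨ false b h = refl

count : ∀ {n} → (Fin n → Bool) → ℕ
count p = sum (λ i → χ (p i))

count-cong : ∀ {n} {p q : Fin n → Bool} → (∀ i → p i ≡ q i) → count p ≡ count q
count-cong h = sum-cong-≗ (λ i → cong χ (h i))

count-all : ∀ n → count {n} (λ _ → true) ≡ n
count-all zero = refl
count-all (suc n) = cong suc (count-all n)

sum-mono : ∀ {n} {f g : Fin n → ℕ} → (∀ i → f i ≤ g i) → sum f ≤ sum g
sum-mono {zero} h = z≤n
sum-mono {suc n} h = +-mono-≤ (h zero) (sum-mono (λ i → h (suc i)))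

sum-zero : ∀ {n} {f : Fin n → ℕ} → (∀ i → f i ≡ 0) → sum f ≡ 0
sum-zero {zero} h = refl
sum-zero {suc n} h = cong₂ _+_ (h zero) (sum-zero (λ i → h (suc i)))

sum-* : ∀ {n} k (f : Fin n → ℕ) → sum (λ w → k * f w) ≡ k * sum f
sum-* {zero} k f = sym (*-zeroʳ k)
sum-* {suc n} k f = trans (cong (k * f zero +_) (sum-* k (λ i → f (suc i)))) (sym (*-distribˡ-+ k (f zero) _))

dropAt : ∀ {n} → Fin n → (Fin n → ℕ) → Fin n → ℕ
dropAt j f i = if i == j then 0 else f i

dropAt-≢ : ∀ {n} {j i : Fin n} f → i ≢ j → dropAt j f i ≡ f i
dropAt-≢ f ne rewrite ==-≢ ne = refl

sum-dropAt : ∀ {n} (j : Fin n) (f : Fin n → ℕ) → sum f ≡ f j + sum (dropAt j f)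
sum-dropAt {suc n} zero f = refl
sum-dropAt {suc n} (suc j) f =
  begin
    f zero + sum (λ i → f (suc i))
  ≡⟨ cong (f zero +_) (sum-dropAt j (λ i → f (suc i))) ⟩
    f zero + (f (suc j) + sum (dropAt j (λ i → f (suc i))))
  ≡⟨ x+[y+z]≡y+[x+z] (f zero) (f (suc j)) _ ⟩
    f (suc j) + (f zero + sum (dropAt j (λ i → f (suc i))))
  ≡⟨ cong (λ z → f (suc j) + (f zero + z)) (sum-cong-≗ shift) ⟩
    f (suc j) + (f zero + sum (λ i → dropAt (suc j) f (suc i)))
  ∎
  where
  open ≡-Reasoning
  x+[y+z]≡y+[x+z] : ∀ x y z → x + (y + z) ≡ y + (x + z)
  x+[y+z]≡y+[x+z] x y z = trans (sym (+-assoc x y z)) (trans (cong (_+ z) (+-comm x y)) (+-assoc y x z))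
  shift : ∀ i → dropAt j (λ i → f (suc i)) i ≡ dropAt (suc j) f (suc i)
  shift i with i ≟ j
  ... | yes refl = refl
  ... | no _ = refl

sum-single : ∀ {n} (j : Fin n) (f : Fin n → ℕ) → (∀ i → i ≢ j → f i ≡ 0) → sum f ≡ f j
sum-single j f h = trans (sum-dropAt j f) (trans (cong (f j +_) (sum-zero rest)) (+-identityʳ (f j)))
  where
  rest : ∀ i → dropAt j f i ≡ 0
  rest i with i ≟ j
  ... | yes refl = refl
  ... | no ne = h i ne

≤-sum : ∀ {n} (j : Fin n) (f : Fin n → ℕ) → f j ≤ sum f
≤-sum j f = subst (f j ≤_) (sym (sum-dropAt j f)) (m≤m+n (f j) _)

sum-nonzero : ∀ {n} (f : Fin n → ℕ) → 1 ≤ sum f → ∃ λ j → 1 ≤ f j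
sum-nonzero {suc n} f h with f zero in e
... | suc _ = zero , subst (1 ≤_) (sym e) (s≤s z≤n)
... | zero with sum-nonzero (λ i → f (suc i)) h
...   | j , q = suc j , q

count-nonzero : ∀ {n} (p : Fin n → Bool) → 1 ≤ count p → ∃ λ j → T (p j)
count-nonzero p h with sum-nonzero (λ i → χ (p i)) h
... | j , q = j , 1≤χ⇒T q

count-zero : ∀ {n} (p : Fin n → Bool) → (∀ i → ¬ T (p i)) → count p ≡ 0
count-zero p h = sum-zero (λ i → χ≡0 (h i))

1≤count : ∀ {n} (p : Fin n → Bool) j → T (p j) → 1 ≤ count p
1≤count p j t = subst (_≤ count p) (χ≡1 t) (≤-sum j (λ i → χ (p i)))

count-mono : ∀ {n} (p q : Fin n → Bool) → (∀ i → T (p i) → T (q i)) → count p ≤ count q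
count-mono p q h = sum-mono pointwise
  where
  pointwise : ∀ i → χ (p i) ≤ χ (q i)
  pointwise i with p i in ep
  ... | false = z≤n
  ... | true rewrite T⇒≡true (h i (subst T (sym ep) tt)) = ≤-refl

remove : ∀ {n} → Fin n → (Fin n → Bool) → Fin n → Bool
remove j p i = p i ∧ not (i == j)

remove⁻ : ∀ {n} {j i : Fin n} {p : Fin n → Bool} → T (remove j p i) → T (p i) × i ≢ j
remove⁻ {j = j} {i} {p} t = T∧₁ t , λ e → T-not⁻ (T∧₂ {p i} t) (subst (λ z → T (z == j)) (sym e) (≡true⇒T (==-refl j)))

remove⁺ : ∀ {n} {j i : Fin n} {p : Fin n → Bool} → T (p i) → i ≢ j → T (remove j p i)
remove⁺ t ne = T∧ t (T-not (≡false⇒¬T (==-≢ ne)))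

count-remove : ∀ {n} (j : Fin n) (p : Fin n → Bool) → T (p j) → count p ≡ suc (count (remove j p))
count-remove j p t = trans (sum-dropAt j (λ i → χ (p i))) (cong₂ _+_ (χ≡1 t) (sum-cong-≗ pointwise))
  where
  pointwise : ∀ i → dropAt j (λ i → χ (p i)) i ≡ χ (remove j p i)
  pointwise i with i ≟ j
  ... | yes refl = sym (cong χ (∧-zeroʳ (p i)))
  ... | no _ = cong χ (sym (∧-identityʳ (p i)))

count≤1 : ∀ {n} (p : Fin n → Bool) → (∀ a b → T (p a) → T (p b) → a ≡ b) → count p ≤ 1
count≤1 p h = bound (count p) refl
  where
  bound : ∀ k → count p ≡ k → count p ≤ 1
  bound zero e = subst (_≤ 1) (sym e) z≤n
  bound (suc k) e with count-nonzero p (subst (1 ≤_) (sym e) (s≤s z≤n))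
  ... | j , t = ≤-reflexive (trans (count-remove j p t) (cong suc rest≡0))
    where
    rest≡0 : count (remove j p) ≡ 0
    rest≡0 = count-zero (remove j p) (λ i ti → proj₂ (remove⁻ {p = p} ti) (h i j (proj₁ (remove⁻ {p = p} ti)) t))

count≤1⇒unique : ∀ {n} (p : Fin n → Bool) → count p ≤ 1 → ∀ a b → T (p a) → T (p b) → a ≡ b
count≤1⇒unique p h a b ta tb with a ≟ b
... | yes e = e
... | no ne = ⊥-elim (<⇒≱ (s≤s (s≤s z≤n)) (≤-trans two≤count h))
  where
  two≤count : 2 ≤ count p
  two≤count rewrite count-remove a p ta = s≤s (1≤count (remove a p) b (remove⁺ {p = p} tb (λ e → ne (sym e))))

length≤count : ∀ {n} (p : Fin n → Bool) (zs : List (Fin n)) → AllPairs _≢_ zs → All (λ z → T (p z)) zs → length zs ≤ count p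
length≤count p [] _ _ = z≤n
length≤count p (z ∷ zs) (d ∷ ds) (t ∷ ts) rewrite count-remove z p t = s≤s (length≤count (remove z p) zs ds (rest zs d ts))
  where
  rest : ∀ xs → All (z ≢_) xs → All (λ x → T (p x)) xs → All (λ x → T (remove z p x)) xs
  rest [] [] [] = []
  rest (x ∷ xs) (nx ∷ dx) (tx ∷ tsx) = remove⁺ {p = p} tx (λ e → nx (sym e)) ∷ rest xs dx tsx

when : Bool → ℕ → ℕ
when true k = k
when false _ = 0

when-T : ∀ {b} k → T b → when b k ≡ k
when-T {true} k _ = refl

when-F : ∀ {b} k → ¬ T b → when b k ≡ 0
when-F {true} k h = ⊥-elim (h tt)
when-F {false} k h = refl

sumOver : ∀ {n} → (Fin n → Bool) → (Fin n → ℕ) → ℕ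
sumOver c f = sum (λ w → when (c w) (f w))

≤-sumOver : ∀ {n} (c : Fin n → Bool) f w → T (c w) → f w ≤ sumOver c f
≤-sumOver c f w t = subst (_≤ sumOver c f) (when-T (f w) t) (≤-sum w (λ w → when (c w) (f w)))

sumOver-mono : ∀ {n} (c : Fin n → Bool) f g → (∀ w → T (c w) → f w ≤ g w) → sumOver c f ≤ sumOver c g
sumOver-mono c f g h = sum-mono pointwise
  where
  pointwise : ∀ w → when (c w) (f w) ≤ when (c w) (g w)
  pointwise w with c w in e
  ... | true = h w (subst T (sym e) tt)
  ... | false = z≤n

sumOver-+ : ∀ {n} (c : Fin n → Bool) f g → sumOver c (λ w → f w + g w) ≡ sumOver c f + sumOver c g
sumOver-+ c f g = trans (sum-cong-≗ pointwise) (∑-distrib-+ (λ w → when (c w) (f w)) (λ w → when (c w) (g w)))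
  where
  pointwise : ∀ w → when (c w) (f w + g w) ≡ when (c w) (f w) + when (c w) (g w)
  pointwise w with c w
  ... | true = refl
  ... | false = refl

sumOver-* : ∀ {n} (c : Fin n → Bool) k f → sumOver c (λ w → k * f w) ≡ k * sumOver c f
sumOver-* c k f = trans (sum-cong-≗ pointwise) (sum-* k (λ w → when (c w) (f w)))
  where
  pointwise : ∀ w → when (c w) (k * f w) ≡ k * when (c w) (f w)
  pointwise w with c w
  ... | true = refl
  ... | false = sym (*-zeroʳ k)

count≤sumOver : ∀ {n} (c : Fin n → Bool) f → (∀ w → T (c w) → 1 ≤ f w) → count c ≤ sumOver c f
count≤sumOver c f h = sum-mono pointwise
  where
  pointwise : ∀ w → χ (c w) ≤ when (c w) (f w)
  pointwise w with c w in ec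
  ... | true = h w (subst T (sym ec) tt)
  ... | false = z≤n

sumOver-count0 : ∀ {n} (c : Fin n → Bool) f → count c ≡ 0 → sumOver c f ≡ 0
sumOver-count0 c f e = sum-zero (λ w → when-F (f w) (λ t → 1+n≰n (≤-trans (1≤count c w t) (≤-reflexive e))))

sumOver-count1 : ∀ {n} (c : Fin n → Bool) f → count c ≡ 1 →
  ∃ λ j → T (c j) × (∀ w → T (c w) → w ≡ j) × sumOver c f ≡ f j
sumOver-count1 c f e with count-nonzero c (≤-reflexive (sym e))
... | j , tj = j , tj , unique , trans (sum-single j _ (λ w ne → when-F (f w) (λ t → ne (unique w t)))) (when-T (f j) tj)
  where
  unique : ∀ w → T (c w) → w ≡ j
  unique w t = count≤1⇒unique c (≤-reflexive e) w j t tj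

sumOver-count2 : ∀ {n} (c : Fin n → Bool) f → count c ≡ 2 →
  ∃₂ λ j₁ j₂ → j₁ ≢ j₂ × T (c j₁) × T (c j₂) × (∀ w → T (c w) → w ≡ j₁ ⊎ w ≡ j₂) × sumOver c f ≡ f j₁ + f j₂
sumOver-count2 c f e with count-nonzero c (≤-trans (s≤s z≤n) (≤-reflexive (sym e)))
... | j₁ , t₁ with sumOver-count1 (remove j₁ c) f (suc-injective (trans (sym (count-remove j₁ c t₁)) e))
...   | j₂ , t₂ , u₂ , s₂ = j₁ , j₂ , (λ q → proj₂ (remove⁻ {p = c} t₂) (sym q)) , t₁ , proj₁ (remove⁻ {p = c} t₂) , both , split
  where
  both : ∀ w → T (c w) → w ≡ j₁ ⊎ w ≡ j₂
  both w t with w ≟ j₁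
  ... | yes q = inj₁ q
  ... | no ne = inj₂ (u₂ w (remove⁺ {p = c} t ne))
  split : sumOver c f ≡ f j₁ + f j₂
  split = trans (sum-dropAt j₁ _) (cong₂ _+_ (when-T (f j₁) t₁) (trans (sum-cong-≗ pointwise) s₂))
    where
    pointwise : ∀ w → dropAt j₁ (λ w → when (c w) (f w)) w ≡ when (remove j₁ c w) (f w)
    pointwise w with w ≟ j₁ | c w
    ... | yes refl | true = refl
    ... | yes refl | false = refl
    ... | no ne | true = refl
    ... | no ne | false = refl

sumOver≡0⇒ : ∀ {n} (c : Fin n → Bool) f → sumOver c f ≡ 0 → ∀ w → T (c w) → f w ≡ 0
sumOver≡0⇒ c f e w t = n≤0⇒n≡0 (≤-trans (≤-sumOver c f w t) (≤-reflexive e))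

sumOver≡1⇒ : ∀ {n} (c : Fin n → Bool) f → sumOver c f ≡ 1 →
  ∃ λ j → T (c j) × f j ≡ 1 × (∀ w → T (c w) → w ≢ j → f w ≡ 0)
sumOver≡1⇒ c f e with sum-nonzero (λ w → when (c w) (f w)) (≤-reflexive (sym e))
... | j , q with c j in ej
...   | false = ⊥-elim (1+n≰n q)
...   | true = j , cj , fj≡1 , others
  where
  cj : T (c j)
  cj = subst T (sym ej) tt
  rest : ℕ
  rest = sum (dropAt j (λ w → when (c w) (f w)))
  split : f j + rest ≡ 1
  split = trans (cong (_+ rest) (sym (when-T (f j) cj))) (trans (sym (sum-dropAt j (λ w → when (c w) (f w)))) e)
  fj≡1 : f j ≡ 1
  fj≡1 = ≤-antisym (≤-trans (m≤m+n (f j) _) (≤-reflexive split)) q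
  rest≡0 : rest ≡ 0
  rest≡0 = +-cancelˡ-≡ 1 _ 0 (trans (cong (_+ rest) (sym fj≡1)) split)
  others : ∀ w → T (c w) → w ≢ j → f w ≡ 0
  others w t ne = n≤0⇒n≡0 (begin
    f w                                    ≡⟨ sym (when-T (f w) t) ⟩
    when (c w) (f w)                       ≡⟨ sym (dropAt-≢ (λ w → when (c w) (f w)) ne) ⟩
    dropAt j (λ w → when (c w) (f w)) w    ≤⟨ ≤-sum w (dropAt j (λ w → when (c w) (f w))) ⟩
    rest                                   ≡⟨ rest≡0 ⟩
    0                                      ∎)
    where open ≤-Reasoning

∈⇒T : ∀ {n} {i : Fin n} {D : Subset n} → i ∈ D → T (lookup D i)
∈⇒T p = ≡true⇒T ([]=⇒lookup p)

T⇒∈ : ∀ {n} {i : Fin n} {D : Subset n} → T (lookup D i) → i ∈ D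
T⇒∈ {i = i} {D} t = lookup⇒[]= i D (T⇒≡true t)

∣∣≡count : ∀ {n} (D : Subset n) → ∣ D ∣ ≡ count (lookup D)
∣∣≡count [] = refl
∣∣≡count (true ∷ D) = cong suc (∣∣≡count D)
∣∣≡count (false ∷ D) = ∣∣≡count D

∣∣≡count-≗ : ∀ {n} (D : Subset n) (p : Fin n → Bool) → (∀ i → lookup D i ≡ p i) → ∣ D ∣ ≡ count p
∣∣≡count-≗ D p h = trans (∣∣≡count D) (count-cong h)

∣tabulate∣ : ∀ {n} (p : Fin n → Bool) → ∣ tabulate p ∣ ≡ count p
∣tabulate∣ p = ∣∣≡count-≗ (tabulate p) p (lookup∘tabulate p)

lookup-∩ : ∀ {n} (D E : Subset n) i → lookup (D ∩ E) i ≡ (lookup D i ∧ lookup E i)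
lookup-∩ D E i = lookup-zipWith _∧_ i D E

subset-ext : ∀ {n} (C D : Subset n) → (∀ i → lookup C i ≡ lookup D i) → C ≡ D
subset-ext C D h = trans (sym (tabulate∘lookup C)) (trans (tabulate-cong h) (tabulate∘lookup D))

3≤count⇒three : ∀ {n} (p : Fin n → Bool) → 3 ≤ count p →
  ∃₂ λ a b → ∃ λ c → (T (p a) × T (p b) × T (p c)) × (a ≢ b × a ≢ c × b ≢ c)
3≤count⇒three p 3≤ with count-nonzero p (≤-trans (s≤s z≤n) 3≤)
... | a , ta with count-nonzero (remove a p) (≤-trans (s≤s z≤n) 2≤)
  where
  2≤ : 2 ≤ count (remove a p)
  2≤ = ≤-pred (subst (3 ≤_) (count-remove a p ta) 3≤)
...   | b , tb' with count-nonzero (remove b (remove a p)) 1≤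
  where
  1≤ : 1 ≤ count (remove b (remove a p))
  1≤ = ≤-pred (≤-pred (subst (3 ≤_) (trans (count-remove a p ta) (cong suc (count-remove b (remove a p) tb'))) 3≤))
...     | c , tc'' = (a , b , c , (ta , tb , tc) , (λ e → b≢a (sym e)) , (λ e → c≢a (sym e)) , (λ e → c≢b (sym e)))
  where
  tb : T (p b)
  tb = proj₁ (remove⁻ {p = p} tb')
  b≢a : b ≢ a
  b≢a = proj₂ (remove⁻ {p = p} tb')
  tc' : T (remove a p c)
  tc' = proj₁ (remove⁻ {p = remove a p} tc'')
  c≢b : c ≢ b
  c≢b = proj₂ (remove⁻ {p = remove a p} tc'')
  tc : T (p c)
  tc = proj₁ (remove⁻ {p = p} tc')
  c≢a : c ≢ a
  c≢a = proj₂ (remove⁻ {p = p} tc')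

some : ∀ {n} → (Fin n → Bool) → Bool
some p = isYes (any? (λ w → T? (p w)))

some⁻ : ∀ {n} {p : Fin n → Bool} → T (some p) → ∃ λ w → T (p w)
some⁻ {p = p} t = toWitness {a? = any? (λ w → T? (p w))} t

some⁺ : ∀ {n} {p : Fin n → Bool} w → T (p w) → T (some p)
some⁺ {p = p} w t = fromWitness {a? = any? (λ w → T? (p w))} (w , t)

χ-some : ∀ {n} (p : Fin n → Bool) → count p ≤ 1 → χ (some p) ≡ count p
χ-some p ≤1 with some p in e
... | true with some⁻ {p = p} (subst T (sym e) tt)
...   | w , t = sym (≤-antisym ≤1 (1≤count p w t))
χ-some p ≤1 | false = sym (count-zero p (λ w t → subst T e (some⁺ w t)))

sum-χ-∧== : ∀ {n} (z : Fin n) (b : Bool) → sum (λ v → χ (b ∧ (v == z))) ≡ χ b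
sum-χ-∧== z b = trans (sum-single z _ others) (cong χ (trans (cong (b ∧_) (==-refl z)) (∧-identityʳ b)))
  where
  others : ∀ v → v ≢ z → χ (b ∧ (v == z)) ≡ 0
  others v ne rewrite ==-≢ ne = cong χ (∧-zeroʳ b)

sum-count-swap : ∀ {n} (c : Fin n → Bool) (D : Fin n → Fin n → Bool) →
  sum (λ v → count (λ w → c w ∧ D w v)) ≡ sumOver c (λ w → count (D w))
sum-count-swap c D = trans (∑-comm (λ v w → χ (c w ∧ D w v))) (sum-cong-≗ pointwise)
  where
  pointwise : ∀ w → sum (λ v → χ (c w ∧ D w v)) ≡ when (c w) (count (D w))
  pointwise w with c w
  ... | true = refl
  ... | false = sum-zero {f = λ v → χ (false ∧ D w v)} (λ _ → refl)

mod3 : ℕ → ℕ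
mod3 0 = 0
mod3 1 = 1
mod3 2 = 2
mod3 (suc (suc (suc n))) = mod3 n

mod3<3 : ∀ n → mod3 n < 3
mod3<3 0 = s≤s z≤n
mod3<3 1 = s≤s (s≤s z≤n)
mod3<3 2 = s≤s (s≤s (s≤s z≤n))
mod3<3 (suc (suc (suc n))) = mod3<3 n

mod3≤ : ∀ n → mod3 n ≤ n
mod3≤ 0 = z≤n
mod3≤ 1 = s≤s z≤n
mod3≤ 2 = s≤s (s≤s z≤n)
mod3≤ (suc (suc (suc n))) = ≤-trans (mod3≤ n) (m≤n+m n 3)

mod3-cases : ∀ n → mod3 n ≡ 0 ⊎ mod3 n ≡ 1 ⊎ mod3 n ≡ 2
mod3-cases n with mod3 n | mod3<3 n
... | 0 | _ = inj₁ refl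
... | 1 | _ = inj₂ (inj₁ refl)
... | 2 | _ = inj₂ (inj₂ refl)
... | suc (suc (suc _)) | s≤s (s≤s (s≤s ()))

mod3-small : ∀ c → c < 3 → mod3 c ≡ c
mod3-small 0 _ = refl
mod3-small 1 _ = refl
mod3-small 2 _ = refl
mod3-small (suc (suc (suc c))) (s≤s (s≤s (s≤s ())))

mod3-idem : ∀ n → mod3 (mod3 n) ≡ mod3 n
mod3-idem n = mod3-small (mod3 n) (mod3<3 n)

mod3-+ˡ : ∀ a b → mod3 (a + b) ≡ mod3 (mod3 a + b)
mod3-+ˡ 0 b = refl
mod3-+ˡ 1 b = refl
mod3-+ˡ 2 b = refl
mod3-+ˡ (suc (suc (suc a))) b = mod3-+ˡ a b

mod3-+ : ∀ a b → mod3 (a + b) ≡ mod3 (mod3 a + mod3 b)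
mod3-+ a b = begin
  mod3 (a + b)               ≡⟨ mod3-+ˡ a b ⟩
  mod3 (mod3 a + b)          ≡⟨ cong mod3 (+-comm (mod3 a) b) ⟩
  mod3 (b + mod3 a)          ≡⟨ mod3-+ˡ b (mod3 a) ⟩
  mod3 (mod3 b + mod3 a)     ≡⟨ cong mod3 (+-comm (mod3 b) (mod3 a)) ⟩
  mod3 (mod3 a + mod3 b)     ∎
  where open ≡-Reasoning

mod3-+-≡ : ∀ {a b i j} → mod3 a ≡ i → mod3 b ≡ j → mod3 (a + b) ≡ mod3 (i + j)
mod3-+-≡ {a} {b} refl refl = mod3-+ a b

mod3-*3 : ∀ q → mod3 (q * 3) ≡ 0
mod3-*3 zero = refl
mod3-*3 (suc q) = mod3-*3 q

mod3-3* : ∀ q → mod3 (3 * q) ≡ 0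
mod3-3* q = trans (cong mod3 (*-comm 3 q)) (mod3-*3 q)

∣⇒mod3≡0 : ∀ {n} → 3 ∣ n → mod3 n ≡ 0
∣⇒mod3≡0 (divides q refl) = mod3-*3 q

mod3≡0⇒∣ : ∀ n → mod3 n ≡ 0 → 3 ∣ n
mod3≡0⇒∣ 0 e = divides 0 refl
mod3≡0⇒∣ (suc (suc (suc n))) e with mod3≡0⇒∣ n e
... | divides q eq = divides (suc q) (cong (3 +_) eq)

mod3-2*≡0 : ∀ n → mod3 (2 * n) ≡ 0 → mod3 n ≡ 0
mod3-2*≡0 0 _ = refl
mod3-2*≡0 (suc (suc (suc n))) e = mod3-2*≡0 n (trans (cong mod3 (sym (*-distribˡ-+ 2 3 n))) e)

mod3-pred : ∀ {x k} → mod3 (suc x) ≡ k → mod3 x ≡ mod3 (2 + k)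
mod3-pred {x} {k} e = begin
  mod3 (3 + x)               ≡⟨ cong mod3 (+-comm 3 x) ⟩
  mod3 (x + 3)               ≡⟨ cong mod3 (+-suc x 2) ⟩
  mod3 (suc x + 2)           ≡⟨ mod3-+ˡ (suc x) 2 ⟩
  mod3 (mod3 (suc x) + 2)    ≡⟨ cong (λ r → mod3 (r + 2)) e ⟩
  mod3 (k + 2)               ≡⟨ cong mod3 (+-comm k 2) ⟩
  mod3 (2 + k)               ∎
  where open ≡-Reasoning

mod3-+-cancelˡ : ∀ a x y → mod3 (a + x) ≡ mod3 (a + y) → mod3 x ≡ mod3 y
mod3-+-cancelˡ zero x y e = e
mod3-+-cancelˡ (suc a) x y e = mod3-+-cancelˡ a x y (trans (mod3-pred {a + x} e) (sym (mod3-pred {a + y} refl)))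

mod3-sum≡2 : ∀ a b → mod3 a ≢ 0 → mod3 b ≢ 0 → mod3 (a + b) ≡ 2 → mod3 a ≡ 1 × mod3 b ≡ 1
mod3-sum≡2 a b a≢0 b≢0 e with mod3-cases a | mod3-cases b
... | inj₁ a0 | _ = ⊥-elim (a≢0 a0)
... | inj₂ _ | inj₁ b0 = ⊥-elim (b≢0 b0)
... | inj₂ (inj₁ a1) | inj₂ (inj₁ b1) = a1 , b1
... | inj₂ (inj₁ a1) | inj₂ (inj₂ b2) = contradiction (trans (sym (mod3-+-≡ {a} {b} a1 b2)) e) λ ()
... | inj₂ (inj₂ a2) | inj₂ (inj₁ b1) = contradiction (trans (sym (mod3-+-≡ {a} {b} a2 b1)) e) λ ()
... | inj₂ (inj₂ a2) | inj₂ (inj₂ b2) = contradiction (trans (sym (mod3-+-≡ {a} {b} a2 b2)) e) λ ()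

mod3-sum : ∀ {n} (g h : Fin n → ℕ) → (∀ i → mod3 (g i) ≡ mod3 (h i)) → mod3 (sum g) ≡ mod3 (sum h)
mod3-sum {zero} g h e = refl
mod3-sum {suc n} g h e = trans (mod3-+ (g zero) _) (trans (cong₂ (λ a b → mod3 (a + b)) (e zero) (mod3-sum (λ i → g (suc i)) (λ i → h (suc i)) (λ i → e (suc i)))) (sym (mod3-+ (h zero) _)))

mod3-when : ∀ b k → mod3 (when b k) ≡ mod3 (when b (mod3 k))
mod3-when true k = sym (mod3-idem k)
mod3-when false k = refl

mod3-triple : ∀ b k → mod3 (χ b + (χ b + (χ b + k))) ≡ mod3 k
mod3-triple true k = refl
mod3-triple false k = refl

-- Two numbers congruent modulo 3 differ by a multiple of 3, so an inequality
-- a ≤ b can be improved by the residue gap c.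
≤-mod3-gap : ∀ a b c → a ≤ b → mod3 b ≡ mod3 (a + c) → c < 3 → a + c ≤ b
≤-mod3-gap a b c a≤b e c<3 = subst (a + c ≤_) (m+[n∸m]≡n a≤b) (+-monoʳ-≤ a c≤d)
  where
  d : ℕ
  d = b ∸ a
  d≡c : mod3 d ≡ mod3 c
  d≡c = mod3-+-cancelˡ a d c (trans (cong mod3 (m+[n∸m]≡n a≤b)) e)
  c≤d : c ≤ d
  c≤d = subst (_≤ d) (trans d≡c (mod3-small c c<3)) (mod3≤ d)

mod3-2*+mod3 : ∀ s → mod3 (2 * s + mod3 s) ≡ 0
mod3-2*+mod3 0 = refl
mod3-2*+mod3 1 = refl
mod3-2*+mod3 2 = refl
mod3-2*+mod3 (suc (suc (suc s))) = trans (cong (λ q → mod3 (q + mod3 s)) (*-distribˡ-+ 2 3 s)) (trans (cong mod3 (+-assoc 6 (2 * s) (mod3 s))) (mod3-2*+mod3 s))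

2*+mod3≤ : ∀ s q → 2 * s ≤ 3 * q → 2 * s + mod3 s ≤ 3 * q
2*+mod3≤ s q h = ≤-mod3-gap (2 * s) (3 * q) (mod3 s) h (trans (mod3-3* q) (sym (mod3-2*+mod3 s))) (mod3<3 s)

2*≤-sharpen : ∀ s q → mod3 s ≡ 0 → 2 * s ≤ 3 * q + 2 → 2 * s ≤ 3 * q
2*≤-sharpen s q e h = +-cancelʳ-≤ 2 (2 * s) (3 * q) (≤-mod3-gap (2 * s) (3 * q + 2) 2 h residues (s≤s (s≤s (s≤s z≤n))))
  where
  2s≡0 : mod3 (2 * s) ≡ 0
  2s≡0 = trans (cong mod3 (sym (+-identityʳ (2 * s)))) (trans (cong (λ q → mod3 (2 * s + q)) (sym e)) (mod3-2*+mod3 s))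
  residues : mod3 (3 * q + 2) ≡ mod3 (2 * s + 2)
  residues = trans (mod3-+ (3 * q) 2) (trans (cong (λ x → mod3 (x + 2)) (trans (mod3-3* q) (sym 2s≡0))) (sym (mod3-+ (2 * s) 2)))

module _ {n} (G : Graph n) where

  adj-sym : ∀ {a b} → Adj G a b → Adj G b a
  adj-sym {a} {b} e = subst T (Graph.sym G a b) e

  adj-irrefl : ∀ {a} → ¬ Adj G a a
  adj-irrefl {a} e = ≡false⇒¬T (irrefl G a) e

  adj⇒≢ : ∀ {a b} → Adj G a b → a ≢ b
  adj⇒≢ e refl = adj-irrefl e

  adj-subst : ∀ {a a' b b'} → a ≡ a' → b ≡ b' → Adj G a b → Adj G a' b'
  adj-subst refl refl e = e

data WalkIn {n} (G : Graph n) (p : Fin n → Bool) : Fin n → Fin n → Set where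
  stop : ∀ {a} → T (p a) → WalkIn G p a a
  move : ∀ {a b c} → T (p a) → Adj G a b → WalkIn G p b c → WalkIn G p a c

module _ {n} {G : Graph n} where

  start∈ : ∀ {p a b} → WalkIn G p a b → T (p a)
  start∈ (stop x) = x
  start∈ (move x _ _) = x

  end∈ : ∀ {p a b} → WalkIn G p a b → T (p b)
  end∈ (stop x) = x
  end∈ (move _ _ w) = end∈ w

  _++ʷ_ : ∀ {p a b c} → WalkIn G p a b → WalkIn G p b c → WalkIn G p a c
  stop _ ++ʷ w = w
  move x e w ++ʷ w' = move x e (w ++ʷ w')

  snoc : ∀ {p a b c} → WalkIn G p a b → Adj G b c → T (p c) → WalkIn G p a c
  snoc w e t = w ++ʷ move (end∈ w) e (stop t)

  reverse : ∀ {p a b} → WalkIn G p a b → WalkIn G p b a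
  reverse (stop x) = stop x
  reverse (move x e w) = snoc (reverse w) (adj-sym G e) x

  weaken : ∀ {p q : Fin n → Bool} {a b} → (∀ v → T (p v) → T (q v)) → WalkIn G p a b → WalkIn G q a b
  weaken h (stop x) = stop (h _ x)
  weaken h (move x e w) = move (h _ x) e (weaken h w)

  restrict : ∀ {p q : Fin n → Bool} {a b} → WalkIn G p a b → (∀ v → WalkIn G p a v → T (q v)) → WalkIn G (λ v → p v ∧ q v) a b
  restrict {p} {q} w h = go (stop (start∈ w)) w
    where
    go : ∀ {x b} → WalkIn G p _ x → WalkIn G p x b → WalkIn G (λ v → p v ∧ q v) x b
    go pre (stop t) = stop (T∧ t (h _ pre))
    go pre (move t e w) = move (T∧ t (h _ pre)) e (go (snoc pre e (start∈ w)) w)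

  leave : ∀ {p a b} → a ≢ b → WalkIn G p a b → ∃ λ c → Adj G a c × WalkIn G (remove a p) c b
  leave {p} {a} a≢b w with go (λ e → a≢b (sym e)) w
    where
    go : ∀ {x b} → b ≢ a → WalkIn G p x b → WalkIn G (remove a p) x b ⊎ (∃ λ c → Adj G a c × WalkIn G (remove a p) c b)
    go b≢a (stop t) = inj₁ (stop (remove⁺ {p = p} t b≢a))
    go b≢a (move {a = x} {b = c} t e w) with go b≢a w
    ... | inj₂ r = inj₂ r
    ... | inj₁ w' with x ≟ a
    ...   | yes refl = inj₂ (c , e , w')
    ...   | no x≢a = inj₁ (move (remove⁺ {p = p} t x≢a) e w')
  ... | inj₂ r = r
  ... | inj₁ w' = ⊥-elim (proj₂ (remove⁻ {p = p} (start∈ w')) refl)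

  walkIn? : ∀ (p : Fin n → Bool) a b → Dec (WalkIn G p a b)
  walkIn? p = bounded (count p) p ≤-refl
    where
    bounded : ∀ k (p : Fin n → Bool) → count p ≤ k → ∀ a b → Dec (WalkIn G p a b)
    bounded k p h a b with p a in pa
    ... | false = no (λ w → subst T pa (start∈ w))
    ... | true with a ≟ b
    ...   | yes refl = yes (stop (subst T (sym pa) tt))
    bounded zero p h a b | true | no a≢b = ⊥-elim (1+n≰n (≤-trans (1≤count p a (subst T (sym pa) tt)) h))
    bounded (suc k) p h a b | true | no a≢b with any? step?
      where
      step? : ∀ c → Dec (Adj G a c × WalkIn G (remove a p) c b)
      step? c with adj G a c
      ... | false = no proj₁
      ... | true with bounded k (remove a p) (≤-pred (subst (_≤ suc k) (count-remove a p (subst T (sym pa) tt)) h)) c b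
      ...   | yes w = yes (tt , w)
      ...   | no nw = no (λ q → nw (proj₂ q))
    ... | yes (c , e , w) = yes (move (subst T (sym pa) tt) e (weaken (λ v → T∧₁) w))
    ... | no none = no (λ w → none (leave a≢b w))

  record PathOfLength (k : ℕ) (p : Fin n → Bool) (a b : Fin n) : Set where
    field
      vs : Fin (suc k) → Fin n
      inj : ∀ i j → vs i ≡ vs j → i ≡ j
      first : vs zero ≡ a
      last : vs (fromℕ k) ≡ b
      allP : ∀ i → T (p (vs i))
      edges : ∀ (i : Fin k) → Adj G (vs (inject₁ i)) (vs (suc i))

  path : ∀ {p a b} → WalkIn G p a b → ∃ λ k → PathOfLength k p a b
  path {p} w = bounded (count p) p ≤-refl w
    where
    bounded : ∀ fuel (p : Fin n → Bool) → count p ≤ fuel → ∀ {a b} → WalkIn G p a b → ∃ λ k → PathOfLength k p a b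
    bounded fuel p h {a} {b} w with a ≟ b
    ... | yes refl = 0 , record { vs = λ _ → a ; inj = λ { zero zero _ → refl } ; first = refl ; last = refl ; allP = λ _ → start∈ w ; edges = λ () }
    bounded zero p h {a} w | no _ = ⊥-elim (1+n≰n (≤-trans (1≤count p a (start∈ w)) h))
    bounded (suc fuel) p h {a} w | no a≢b with leave a≢b w
    ... | c , e , w' with bounded fuel (remove a p) (≤-pred (subst (_≤ suc fuel) (count-remove a p (start∈ w)) h)) w'
    ...   | k , P = suc k , record { vs = vs' ; inj = inj' ; first = refl ; last = last ; allP = allP' ; edges = edges' }
      where
      open PathOfLength P
      vs' : Fin (suc (suc k)) → Fin n
      vs' zero = a
      vs' (suc i) = vs i
      vs≢a : ∀ i → vs i ≢ a
      vs≢a i = proj₂ (remove⁻ {p = p} (allP i))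
      inj' : ∀ i j → vs' i ≡ vs' j → i ≡ j
      inj' zero zero _ = refl
      inj' zero (suc j) q = ⊥-elim (vs≢a j (sym q))
      inj' (suc i) zero q = ⊥-elim (vs≢a i q)
      inj' (suc i) (suc j) q = cong suc (inj i j q)
      allP' : ∀ i → T (p (vs' i))
      allP' zero = start∈ w
      allP' (suc i) = proj₁ (remove⁻ {p = p} (allP i))
      edges' : ∀ (i : Fin (suc k)) → Adj G (vs' (inject₁ i)) (vs' (suc i))
      edges' zero = adj-subst G refl (sym first) e
      edges' (suc i) = edges i

avoid : ∀ {n} → Fin n → Fin n → Bool
avoid y v = not (v == y)

avoid⁺ : ∀ {n} {y v : Fin n} → v ≢ y → T (avoid y v)
avoid⁺ ne = T-not (≡false⇒¬T (==-≢ ne))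

avoid⁻ : ∀ {n} {y v : Fin n} → T (avoid y v) → v ≢ y
avoid⁻ {y = y} t e = T-not⁻ t (subst (λ z → T (z == y)) (sym e) (≡true⇒T (==-refl y)))

-- A path of positive length between z₁ and z₂ would close a cycle through y.
acyclic⇒neighbours-separated : ∀ {n} {G : Graph n} → Acyclic G → ∀ {y z₁ z₂} →
  Adj G y z₁ → Adj G y z₂ → WalkIn G (avoid y) z₁ z₂ → z₁ ≡ z₂
acyclic⇒neighbours-separated {n} {G} ac {y} {z₁} {z₂} e₁ e₂ w with path w
... | zero , P = trans (sym first) last
  where open PathOfLength P
... | suc m , P = ⊥-elim (ac cycle)
  where
  open PathOfLength P
  vtx : Fin (3 + m) → Fin n
  vtx zero = y
  vtx (suc i) = vs i
  vtx-inj : ∀ i j → vtx i ≡ vtx j → i ≡ j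
  vtx-inj zero zero _ = refl
  vtx-inj zero (suc j) q = ⊥-elim (avoid⁻ (allP j) (sym q))
  vtx-inj (suc i) zero q = ⊥-elim (avoid⁻ (allP i) q)
  vtx-inj (suc i) (suc j) q = cong suc (inj i j q)
  vtx-edges : ∀ (i : Fin (2 + m)) → Adj G (vtx (inject₁ i)) (vtx (suc i))
  vtx-edges zero = adj-subst G refl (sym first) e₁
  vtx-edges (suc i) = edges i
  cycle : Cycle G
  cycle = record { m = m ; vtx = vtx ; inj = vtx-inj _ _ ; edges = vtx-edges ; close = adj-subst G (sym last) refl (adj-sym G e₂) }

fromWalk : ∀ {n} {G : Graph n} {a b} → Walk G a b → WalkIn G (λ _ → true) a b
fromWalk here = stop tt
fromWalk (step e w) = move tt e (fromWalk w)

toWalk : ∀ {n} {G : Graph n} {p a b} → WalkIn G p a b → Walk G a b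
toWalk (stop _) = here
toWalk (move _ e w) = step e (toWalk w)

fromWalkAvoid : ∀ {n} {G : Graph n} {y a b} → WalkAvoid G y a b → WalkIn G (avoid y) a b
fromWalkAvoid (here ne) = stop (avoid⁺ ne)
fromWalkAvoid (step ne e w) = move (avoid⁺ ne) e (fromWalkAvoid w)

toWalkAvoid : ∀ {n} {G : Graph n} {y a b} → WalkIn G (avoid y) a b → WalkAvoid G y a b
toWalkAvoid (stop t) = here (avoid⁻ t)
toWalkAvoid (move t e w) = step (avoid⁻ t) e (toWalkAvoid w)

map-walk : ∀ {n m} {G : Graph n} {H : Graph m} (f : Fin m → Fin n) →
  (∀ i j → Adj H i j → Adj G (f i) (f j)) →
  ∀ {p p'} → (∀ v → T (p' v) → T (p (f v))) → ∀ {a b} → WalkIn H p' a b → WalkIn G p (f a) (f b)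
map-walk f hom pc (stop t) = stop (pc _ t)
map-walk f hom pc (move t e w) = move (pc _ t) (hom _ _ e) (map-walk f hom pc w)

project-walk : ∀ {n m} {G : Graph n} {H : Graph m} (g : Fin n → Fin m) →
  (∀ a b → Adj G a b → g a ≡ g b ⊎ Adj H (g a) (g b)) →
  ∀ {p p'} → (∀ v → T (p v) → T (p' (g v))) → ∀ {a b} → WalkIn G p a b → WalkIn H p' (g a) (g b)
project-walk g proj pc (stop t) = stop (pc _ t)
project-walk {H = H} g proj {p' = p'} pc (move {a} {b} {c} t e w) with proj a b e
... | inj₁ eq = subst (λ q → WalkIn H p' q (g c)) (sym eq) (project-walk g proj pc w)
... | inj₂ e' = move (pc _ t) e' (project-walk g proj pc w)

-- branch y z v: v lies in the component of G - y containing z.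
module Branches {n} (G : Graph n) (tr : IsTree G) where

  open IsTree tr

  opaque
    branch : Fin n → Fin n → Fin n → Bool
    branch y z v = isYes (walkIn? {G = G} (avoid y) z v)

  size : Fin n → Fin n → ℕ
  size y z = count (branch y z)

  opaque
    unfolding branch

    branch⇒walk : ∀ {y z v} → T (branch y z v) → WalkIn G (avoid y) z v
    branch⇒walk {y} {z} {v} t = toWitness {a? = walkIn? {G = G} (avoid y) z v} t

    walk⇒branch : ∀ {y z v} → WalkIn G (avoid y) z v → T (branch y z v)
    walk⇒branch {y} {z} {v} w = fromWitness {a? = walkIn? {G = G} (avoid y) z v} w

  branch-root : ∀ {y z} → Adj G y z → T (branch y z z)
  branch-root e = walk⇒branch (stop (avoid⁺ (λ q → adj⇒≢ G e (sym q))))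

  branch⇒≢ : ∀ {y z v} → T (branch y z v) → v ≢ y
  branch⇒≢ t = avoid⁻ (end∈ (branch⇒walk t))

  branch-step : ∀ {y z v u} → T (branch y z v) → Adj G v u → u ≢ y → T (branch y z u)
  branch-step t e ne = walk⇒branch (snoc (branch⇒walk t) e (avoid⁺ ne))

  branch-unique : ∀ {y z₁ z₂ v} → Adj G y z₁ → Adj G y z₂ → T (branch y z₁ v) → T (branch y z₂ v) → z₁ ≡ z₂
  branch-unique e₁ e₂ t₁ t₂ = acyclic⇒neighbours-separated acyclic e₁ e₂ (branch⇒walk t₁ ++ʷ reverse (branch⇒walk t₂))

  entry : ∀ {p : Fin n → Bool} {x y} → WalkIn G p x y → x ≢ y → ∃ λ z → Adj G y z × WalkIn G (λ v → p v ∧ avoid y v) z x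
  entry (stop t) ne = ⊥-elim (ne refl)
  entry {x = x} {y} (move {b = c} t e w) ne with c ≟ y
  ... | yes refl = x , adj-sym G e , stop (T∧ t (avoid⁺ ne))
  ... | no c≢y with entry w c≢y
  ...   | z , ez , wz = z , ez , snoc wz (adj-sym G e) (T∧ t (avoid⁺ ne))

  branch-cover : ∀ {y v} → v ≢ y → ∃ λ z → Adj G y z × T (branch y z v)
  branch-cover {y} {v} ne with entry (fromWalk (connected v y)) ne
  ... | z , ez , wz = z , ez , walk⇒branch (weaken (λ _ t → t) wz)

  branch-walk-within : ∀ {y z v} (q : Fin n → Bool) → T (branch y z v) → (∀ u → T (branch y z u) → T (q u)) →
    WalkIn G (λ u → avoid y u ∧ q u) z v
  branch-walk-within q t h = restrict (branch⇒walk t) (λ u w → h u (walk⇒branch w))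

  branch-complement : ∀ {y z} → Adj G y z → ∀ v → T (branch y z v) ⊎ T (branch z y v)
  branch-complement {y} {z} e v with v ≟ y
  ... | yes refl = inj₂ (branch-root (adj-sym G e))
  ... | no v≢y with branch-cover v≢y
  ...   | z' , ez' , t' with z' ≟ z
  ...     | yes refl = inj₁ t'
  ...     | no z'≢z = inj₂ (walk⇒branch (move (avoid⁺ (adj⇒≢ G e)) ez' (weaken (λ u t → T∧₂ {avoid y u} t) avoiding-z)))
    where
    avoiding-z : WalkIn G (λ u → avoid y u ∧ avoid z u) z' v
    avoiding-z = branch-walk-within (avoid z) t' (λ u tu → avoid⁺ (λ u≡z → z'≢z (branch-unique ez' e tu (subst (λ q → T (branch y z q)) (sym u≡z) (branch-root e)))))

  branch-exclusive : ∀ {y z v} → Adj G y z → T (branch y z v) → T (branch z y v) → ⊥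
  branch-exclusive {y} {z} e t₁ t₂ with entry (reverse (branch⇒walk t₂)) (branch⇒≢ t₁)
  ... | z' , ez' , w' = avoid⁻ (T∧₁ (start∈ w')) (sym (branch-unique e ez' t₁ (walk⇒branch (weaken (λ u t → T∧₂ {avoid z u} t) w'))))

  1≤size : ∀ {y z} → Adj G y z → 1 ≤ size y z
  1≤size {y} {z} e = 1≤count (branch y z) z (branch-root e)

  size+size≡n : ∀ {y z} → Adj G y z → size y z + size z y ≡ n
  size+size≡n {y} {z} e = trans (sym (∑-distrib-+ (λ v → χ (branch y z v)) (λ v → χ (branch z y v)))) (trans (sum-cong-≗ one) (count-all n))
    where
    one : ∀ v → χ (branch y z v) + χ (branch z y v) ≡ χ true
    one v with branch-complement e v
    ... | inj₁ t₁ rewrite χ≡1 t₁ | χ≡0 (λ t₂ → branch-exclusive e t₁ t₂) = refl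
    ... | inj₂ t₂ rewrite χ≡1 t₂ | χ≡0 (λ t₁ → branch-exclusive e t₁ t₂) = refl

  n≡1+∑branches : ∀ y → n ≡ suc (sumOver (adj G y) (size y))
  n≡1+∑branches y = begin
    n                                      ≡⟨ sym (count-all n) ⟩
    count {n} (λ _ → true)                 ≡⟨ count-remove y (λ _ → true) tt ⟩
    suc (count (avoid y))                  ≡⟨ cong suc (trans (sum-cong-≗ inner) (trans (∑-comm (λ v z → χ (adj G y z ∧ branch y z v))) (sum-cong-≗ outer))) ⟩
    suc (sumOver (adj G y) (size y))       ∎
    where
    open ≡-Reasoning
    inner : ∀ v → χ (avoid y v) ≡ sum (λ z → χ (adj G y z ∧ branch y z v))
    inner v with v ≟ y
    ... | yes refl = sym (sum-zero (λ z → χ≡0 (λ t → branch⇒≢ (T∧₂ {adj G y z} t) refl)))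
    ... | no v≢y with branch-cover v≢y
    ...   | z₀ , e₀ , t₀ = sym (trans (sum-single z₀ _ others) (χ≡1 (T∧ e₀ t₀)))
      where
      others : ∀ z → z ≢ z₀ → χ (adj G y z ∧ branch y z v) ≡ 0
      others z ne = χ≡0 (λ t → ne (branch-unique (T∧₁ t) e₀ (T∧₂ {adj G y z} t) t₀))
    outer : ∀ z → sum (λ v → χ (adj G y z ∧ branch y z v)) ≡ when (adj G y z) (size y z)
    outer z with adj G y z
    ... | true = refl
    ... | false = sum-zero {f = λ v → χ (false ∧ branch y z v)} (λ _ → refl)

  child : Fin n → Fin n → Fin n → Bool
  child y z w = adj G z w ∧ avoid y w

  child⇒adj : ∀ {y z w} → T (child y z w) → Adj G z w
  child⇒adj t = T∧₁ t

  child⇒≢ : ∀ {y z w} → T (child y z w) → w ≢ y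
  child⇒≢ {z = z} {w} t = avoid⁻ (T∧₂ {adj G z w} t)

  adj⇒parent-or-child : ∀ {y z u} → Adj G z u → u ≡ y ⊎ T (child y z u)
  adj⇒parent-or-child {y} {u = u} e = decide (u ≟ y)
    where
    decide : Dec (u ≡ y) → u ≡ y ⊎ T (child y _ u)
    decide (yes q) = inj₁ q
    decide (no ne) = inj₂ (T∧ e (avoid⁺ ne))

  size≡1+∑children : ∀ {y z} → Adj G y z → size y z ≡ suc (sumOver (child y z) (size z))
  size≡1+∑children {y} {z} e = +-cancelʳ-≡ (size z y) _ _ (begin
    size y z + size z y                              ≡⟨ size+size≡n e ⟩
    n                                                ≡⟨ n≡1+∑branches z ⟩
    suc (sumOver (adj G z) (size z))                 ≡⟨ cong suc (trans (sum-dropAt y _) (cong₂ _+_ parent (sum-cong-≗ children))) ⟩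
    suc (size z y + S)                               ≡⟨ cong suc (+-comm (size z y) S) ⟩
    suc S + size z y                                 ∎)
    where
    open ≡-Reasoning
    S : ℕ
    S = sumOver (child y z) (size z)
    parent : when (adj G z y) (size z y) ≡ size z y
    parent = when-T (size z y) (adj-sym G e)
    children : ∀ w → dropAt y (λ w → when (adj G z w) (size z w)) w ≡ when (child y z w) (size z w)
    children w with w ≟ y
    ... | yes refl = sym (cong (λ b → when b (size z w)) (∧-zeroʳ (adj G z w)))
    ... | no _ with adj G z w
    ...   | true = refl
    ...   | false = refl

  size-child< : ∀ {y z w} → Adj G y z → T (child y z w) → size z w < size y z
  size-child< {y} {z} {w} e c = subst (size z w <_) (sym (size≡1+∑children e)) (s≤s (≤-sumOver (child y z) (size z) w c))

  branch-child⊆ : ∀ {y z w v} → Adj G y z → T (child y z w) → T (branch z w v) → T (branch y z v)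
  branch-child⊆ {y} {z} {w} e c t = walk⇒branch (move (avoid⁺ (λ q → adj⇒≢ G e (sym q))) (child⇒adj c) (weaken (λ u t → T∧₂ {avoid z u} t) avoiding-y))
    where
    avoiding-y : WalkIn G (λ u → avoid z u ∧ avoid y u) w _
    avoiding-y = branch-walk-within (avoid y) t (λ u tu → avoid⁺ (λ u≡y → child⇒≢ c (branch-unique (child⇒adj c) (adj-sym G e) (subst (λ q → T (branch z w q)) u≡y tu) (branch-root (adj-sym G e)))))

  bad : Fin n → Fin n → Bool
  bad y z = not (mod3 (size y z) ≡ᵇ 0)

  bad⁺ : ∀ {y z} → mod3 (size y z) ≢ 0 → T (bad y z)
  bad⁺ {y} {z} ne with mod3 (size y z)
  ... | zero = ne refl
  ... | suc _ = tt

  bad⁻ : ∀ {y z} → T (bad y z) → mod3 (size y z) ≢ 0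
  bad⁻ {y} {z} t with mod3 (size y z)
  bad⁻ () | zero
  ... | suc _ = λ ()

  badNeighbour : Fin n → Fin n → Bool
  badNeighbour y z = adj G y z ∧ bad y z

  FewBad : Fin n → Set
  FewBad y = count (badNeighbour y) ≤ 2

  branchSet : Fin n → Fin n → Subset n
  branchSet y z = tabulate (branch y z)

  lookup-branchSet : ∀ y z v → lookup (branchSet y z) v ≡ branch y z v
  lookup-branchSet y z v = lookup∘tabulate (branch y z) v

  ∈branchSet⇔ : ∀ {y z v} → v ∈ branchSet y z ⇔ T (branch y z v)
  ∈branchSet⇔ {y} {z} {v} = mk⇔ (λ m → subst T (lookup-branchSet y z v) (∈⇒T m)) (λ t → T⇒∈ (subst T (sym (lookup-branchSet y z v)) t))

  branch-isComponent : ∀ {y z} → Adj G y z → IsComponentMinus G y (branchSet y z)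
  branch-isComponent {y} {z} e = (z , from (branch-root e)) , (λ m → branch⇒≢ (to m) refl) , walks
    where
    to : ∀ {v} → v ∈ branchSet y z → T (branch y z v)
    to = Equivalence.to ∈branchSet⇔
    from : ∀ {v} → T (branch y z v) → v ∈ branchSet y z
    from = Equivalence.from ∈branchSet⇔
    walks : ∀ a b → a ∈ branchSet y z → (b ∈ branchSet y z ⇔ WalkAvoid G y a b)
    walks a b ma = mk⇔ (λ mb → toWalkAvoid (reverse z→a ++ʷ branch⇒walk (to mb))) (λ w → from (walk⇒branch (z→a ++ʷ fromWalkAvoid w)))
      where
      z→a : WalkIn G (avoid y) z a
      z→a = branch⇒walk (to ma)

  component⇒branch : ∀ {y C} → IsComponentMinus G y C → ∃ λ z → Adj G y z × (∀ v → lookup C v ≡ branch y z v)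
  component⇒branch {y} {C} ((a , ma) , y∉C , walks) with branch-cover {y} {a} (λ e → y∉C (subst (_∈ C) e ma))
  ... | z , ez , ta = z , ez , λ v → T-ext (to v) (from v)
    where
    z→a : WalkIn G (avoid y) z a
    z→a = branch⇒walk ta
    to : ∀ v → T (lookup C v) → T (branch y z v)
    to v t = walk⇒branch (z→a ++ʷ fromWalkAvoid (Equivalence.to (walks a v ma) (T⇒∈ t)))
    from : ∀ v → T (branch y z v) → T (lookup C v)
    from v t = ∈⇒T (Equivalence.from (walks a v ma) (toWalkAvoid (reverse z→a ++ʷ branch⇒walk t)))

  atMostTwoBad⇒fewBad : ∀ y → AtMostTwoBadComponents G y → FewBad y
  atMostTwoBad⇒fewBad y h with 3 ≤? count (badNeighbour y)
  ... | no ≱3 = ≤-pred (≰⇒> ≱3)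
  ... | yes ≥3 = ⊥-elim (three-bad (3≤count⇒three (badNeighbour y) ≥3))
    where
    separate : ∀ {u v} → T (badNeighbour y u) → T (badNeighbour y v) → u ≢ v → branchSet y u ≢ branchSet y v
    separate {u} {v} tu tv u≢v eq = u≢v (branch-unique (T∧₁ tu) (T∧₁ tv) (branch-root (T∧₁ tu)) (subst T (trans (sym (lookup-branchSet y u u)) (trans (cong (λ C → lookup C u) eq) (lookup-branchSet y v u))) (branch-root (T∧₁ tu))))
    badComponent : ∀ {z} → T (badNeighbour y z) → IsComponentMinus G y (branchSet y z) × ¬ (3 ∣ ∣ branchSet y z ∣)
    badComponent {z} t = branch-isComponent (T∧₁ t) , λ d → bad⁻ (T∧₂ {adj G y z} t) (∣⇒mod3≡0 (subst (3 ∣_) (∣tabulate∣ (branch y z)) d))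
    three-bad : (∃₂ λ a b → ∃ λ c → (T (badNeighbour y a) × T (badNeighbour y b) × T (badNeighbour y c)) × (a ≢ b × a ≢ c × b ≢ c)) → ⊥
    three-bad (a , b , c , (ta , tb , tc) , (a≢b , a≢c , b≢c)) =
      1+n≰n (h (branchSet y a ∷ branchSet y b ∷ branchSet y c ∷ [])
               ((separate ta tb a≢b ∷ separate ta tc a≢c ∷ []) ∷ (separate tb tc b≢c ∷ []) ∷ [] ∷ [])
               (badComponent ta ∷ badComponent tb ∷ badComponent tc ∷ []))

  fewBad⇒atMostTwoBad : ∀ y → FewBad y → AtMostTwoBadComponents G y
  fewBad⇒atMostTwoBad y few Cs distinct bads = ≤-trans (subst (_≤ count (badNeighbour y)) (length-roots Cs bads) (length≤count (badNeighbour y) (roots Cs bads) (roots-distinct Cs distinct bads) (roots-bad Cs bads))) few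
    where
    BadComponent : Subset n → Set
    BadComponent C = IsComponentMinus G y C × ¬ (3 ∣ ∣ C ∣)
    root : ∀ {C} → BadComponent C → Fin n
    root p = proj₁ (component⇒branch (proj₁ p))
    root-bad : ∀ {C} (p : BadComponent C) → T (badNeighbour y (root p))
    root-bad {C} p = T∧ e (bad⁺ (λ r → proj₂ p (subst (3 ∣_) (sym (∣∣≡count-≗ C (branch y z) C≡)) (mod3≡0⇒∣ _ r))))
      where
      z : Fin n
      z = root p
      e : Adj G y z
      e = proj₁ (proj₂ (component⇒branch (proj₁ p)))
      C≡ : ∀ v → lookup C v ≡ branch y z v
      C≡ = proj₂ (proj₂ (component⇒branch (proj₁ p)))
    root-injective : ∀ {C D} (p : BadComponent C) (q : BadComponent D) → root p ≡ root q → C ≡ D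
    root-injective {C} {D} p q e = subset-ext C D (λ v → trans (proj₂ (proj₂ (component⇒branch (proj₁ p))) v) (trans (cong (λ u → branch y u v) e) (sym (proj₂ (proj₂ (component⇒branch (proj₁ q))) v))))
    roots : ∀ Cs → All BadComponent Cs → List (Fin n)
    roots [] [] = []
    roots (C ∷ Cs) (p ∷ ps) = root p ∷ roots Cs ps
    length-roots : ∀ Cs (ps : All BadComponent Cs) → length (roots Cs ps) ≡ length Cs
    length-roots [] [] = refl
    length-roots (C ∷ Cs) (p ∷ ps) = cong suc (length-roots Cs ps)
    roots-bad : ∀ Cs (ps : All BadComponent Cs) → All (λ z → T (badNeighbour y z)) (roots Cs ps)
    roots-bad [] [] = []
    roots-bad (C ∷ Cs) (p ∷ ps) = root-bad p ∷ roots-bad Cs ps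
    root-fresh : ∀ {C} (p : BadComponent C) Cs → All (C ≢_) Cs → (ps : All BadComponent Cs) → All (root p ≢_) (roots Cs ps)
    root-fresh p [] [] [] = []
    root-fresh p (D ∷ Ds) (nd ∷ nds) (q ∷ qs) = (λ e → nd (root-injective p q e)) ∷ root-fresh p Ds nds qs
    roots-distinct : ∀ Cs → AllPairs _≢_ Cs → (ps : All BadComponent Cs) → AllPairs _≢_ (roots Cs ps)
    roots-distinct [] [] [] = []
    roots-distinct (C ∷ Cs) (d ∷ ds) (p ∷ ps) = root-fresh p Cs d ps ∷ roots-distinct Cs ds ps

-- Trees in 𝒯 have dissociation number 2n/3

degreeIn : ∀ {n} → Graph n → Subset n → Fin n → ℕ
degreeIn G D v = count (λ i → lookup D i ∧ adj G v i)

Dissociation : ∀ {n} → Graph n → Subset n → Set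
Dissociation G D = ∀ v → T (lookup D v) → degreeIn G D v ≤ 1

∣∩nbhd∣≡degreeIn : ∀ {n} (G : Graph n) D v → ∣ D ∩ nbhd G v ∣ ≡ degreeIn G D v
∣∩nbhd∣≡degreeIn G D v = ∣∣≡count-≗ (D ∩ nbhd G v) _ (λ i → trans (lookup-∩ D (nbhd G v) i) (cong (lookup D i ∧_) (lookup∘tabulate (adj G v) i)))

isDissociation⇒ : ∀ {n} (G : Graph n) D → IsDissociation G D → Dissociation G D
isDissociation⇒ G D h v t = subst (_≤ 1) (∣∩nbhd∣≡degreeIn G D v) (h v (T⇒∈ t))

⇒isDissociation : ∀ {n} (G : Graph n) D → Dissociation G D → IsDissociation G D
⇒isDissociation G D h v m = subst (_≤ 1) (sym (∣∩nbhd∣≡degreeIn G D v)) (h v (∈⇒T m))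

TwoThirds : ∀ {n} → Graph n → Set
TwoThirds {n} G = (Σ (Subset n) λ D → Dissociation G D × 3 * ∣ D ∣ ≡ 2 * n) × (∀ D → Dissociation G D → 3 * ∣ D ∣ ≤ 2 * n)

twoThirds⇒diss : ∀ {n} {G : Graph n} → TwoThirds G → ∃ λ k → IsDissNumber G k × 3 * k ≡ 2 * n
twoThirds⇒diss {n} {G} ((D , d , e) , upper) = ∣ D ∣ , ((D , ⇒isDissociation G D d , refl) , maximal) , e
  where
  maximal : ∀ E → IsDissociation G E → ∣ E ∣ ≤ ∣ D ∣
  maximal E dE = *-cancelˡ-≤ 3 (≤-trans (upper E (isDissociation⇒ G E dE)) (≤-reflexive (sym e)))

diss⇒upper : ∀ {n} {G : Graph n} {k} → IsDissNumber G k → 3 * k ≡ 2 * n → ∀ D → Dissociation G D → 3 * ∣ D ∣ ≤ 2 * n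
diss⇒upper {G = G} (_ , maximal) e D d = ≤-trans (*-monoʳ-≤ 3 (maximal D (⇒isDissociation G D d))) (≤-reflexive e)

P3-twoThirds : TwoThirds P3
P3-twoThirds = (true ∷ true ∷ false ∷ [] , dissociation , refl) , upper
  where
  dissociation : Dissociation P3 (true ∷ true ∷ false ∷ [])
  dissociation zero _ = s≤s z≤n
  dissociation (suc zero) _ = s≤s z≤n
  dissociation (suc (suc zero)) ()
  upper : ∀ D → Dissociation P3 D → 3 * ∣ D ∣ ≤ 6
  upper (a ∷ b ∷ c ∷ []) d with a | b | c | d (suc zero)
  ... | true | true | true | h = ⊥-elim (1+n≰n (h tt))
  ... | true | true | false | _ = ≤-refl
  ... | true | false | true | _ = ≤-refl
  ... | true | false | false | _ = s≤s (s≤s (s≤s z≤n))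
  ... | false | true | true | _ = ≤-refl
  ... | false | true | false | _ = s≤s (s≤s (s≤s z≤n))
  ... | false | false | true | _ = s≤s (s≤s (s≤s z≤n))
  ... | false | false | false | _ = z≤n

-- A dissociation set contains at most two of the three new vertices, and the
-- new vertices 0 and 1 can always be added to one of G.
module _ {n} (G : Graph n) (x : Fin n) where

  private
    3*-step : ∀ k → 3 * k ≡ 2 * n → 3 * (2 + k) ≡ 2 * (3 + n)
    3*-step k e = begin
      3 * (2 + k)      ≡⟨ *-distribˡ-+ 3 2 k ⟩
      6 + 3 * k        ≡⟨ cong (6 +_) e ⟩
      6 + 2 * n        ≡⟨ sym (*-distribˡ-+ 2 3 n) ⟩
      2 * (3 + n)      ∎
      where open ≡-Reasoning

    3*-step-≤ : ∀ a k → a ≤ 2 → 3 * k ≤ 2 * n → 3 * (a + k) ≤ 2 * (3 + n)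
    3*-step-≤ a k a≤2 le = begin
      3 * (a + k)      ≡⟨ *-distribˡ-+ 3 a k ⟩
      3 * a + 3 * k    ≤⟨ +-mono-≤ (*-monoʳ-≤ 3 a≤2) le ⟩
      6 + 2 * n        ≡⟨ sym (*-distribˡ-+ 2 3 n) ⟩
      2 * (3 + n)      ∎
      where open ≤-Reasoning

    ∣∷∷∷∣ : ∀ (a b c : Bool) (D : Subset n) → ∣ a ∷ b ∷ c ∷ D ∣ ≡ (χ a + (χ b + χ c)) + ∣ D ∣
    ∣∷∷∷∣ a b c D = trans (∣∣≡count (a ∷ b ∷ c ∷ D)) (trans (cong (χ a +_) (sym (+-assoc (χ b) (χ c) _))) (trans (sym (+-assoc (χ a) _ _)) (cong ((χ a + (χ b + χ c)) +_) (sym (∣∣≡count D)))))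

    not-all-three : ∀ a b c → ¬ (T a × T b × T c) → χ a + (χ b + χ c) ≤ 2
    not-all-three true true true h = ⊥-elim (h (tt , tt , tt))
    not-all-three true true false h = ≤-refl
    not-all-three true false true h = ≤-refl
    not-all-three true false false h = s≤s z≤n
    not-all-three false true true h = ≤-refl
    not-all-three false true false h = s≤s z≤n
    not-all-three false false true h = s≤s z≤n
    not-all-three false false false h = z≤n

    count-∧false : (p : Fin n → Bool) → count (λ i → p i ∧ false) ≡ 0
    count-∧false p = sum-zero (λ i → cong χ (∧-zeroʳ (p i)))

    ≤1-tail : ∀ a b c k → a + (b + (c + k)) ≤ 1 → k ≤ 1
    ≤1-tail a b c k h = ≤-trans (≤-trans (m≤n+m k c) (≤-trans (m≤n+m _ b) (m≤n+m _ a))) h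

  O1-twoThirds : TwoThirds G → TwoThirds (O1 G x)
  O1-twoThirds ((D' , d' , e') , upper') = (true ∷ true ∷ false ∷ D' , dissociation , 3*-step _ e') , upper
    where
    dissociation : Dissociation (O1 G x) (true ∷ true ∷ false ∷ D')
    dissociation zero _ = subst (_≤ 1) (sym (cong suc (count-∧false (lookup D')))) ≤-refl
    dissociation (suc zero) _ = subst (_≤ 1) (sym (cong suc (count-∧false (lookup D')))) ≤-refl
    dissociation (suc (suc (suc i))) t = d' i t
    upper : ∀ E → Dissociation (O1 G x) E → 3 * ∣ E ∣ ≤ 2 * (3 + n)
    upper (a ∷ b ∷ c ∷ E') dE = subst (λ q → 3 * q ≤ 2 * (3 + n)) (sym (∣∷∷∷∣ a b c E')) (3*-step-≤ _ _ (not-all-three a b c ¬abc) (upper' E' dE'))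
      where
      dE' : Dissociation G E'
      dE' i t = ≤1-tail (χ (a ∧ false)) (χ (b ∧ false)) (χ (c ∧ isV x i)) _ (dE (suc (suc (suc i))) t)
      -- v = 1 would have both u = 0 and w = 2 as neighbours in E
      ¬abc : ¬ (T a × T b × T c)
      ¬abc (ta , tb , tc) = 1+n≰n (≤-trans (two a c ta tc) (dE (suc zero) tb))
        where
        two : ∀ a c → T a → T c → 2 ≤ χ (a ∧ true) + (χ (b ∧ false) + (χ (c ∧ true) + count (λ i → lookup E' i ∧ false)))
        two true true _ _ = s≤s (≤-trans (s≤s z≤n) (m≤n+m _ (χ (b ∧ false))))

  O2-twoThirds : TwoThirds G → TwoThirds (O2 G x)
  O2-twoThirds ((D' , d' , e') , upper') = (true ∷ true ∷ false ∷ D' , dissociation , 3*-step _ e') , upper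
    where
    dissociation : Dissociation (O2 G x) (true ∷ true ∷ false ∷ D')
    dissociation zero _ = subst (_≤ 1) (sym (count-∧false (lookup D'))) z≤n
    dissociation (suc zero) _ = subst (_≤ 1) (sym (count-∧false (lookup D'))) z≤n
    dissociation (suc (suc (suc i))) t = d' i t
    upper : ∀ E → Dissociation (O2 G x) E → 3 * ∣ E ∣ ≤ 2 * (3 + n)
    upper (a ∷ b ∷ c ∷ E') dE = subst (λ q → 3 * q ≤ 2 * (3 + n)) (sym (∣∷∷∷∣ a b c E')) (3*-step-≤ _ _ (not-all-three a b c ¬abc) (upper' E' dE'))
      where
      dE' : Dissociation G E'
      dE' i t = ≤1-tail (χ (a ∧ false)) (χ (b ∧ false)) (χ (c ∧ isV x i)) _ (dE (suc (suc (suc i))) t)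
      -- v = 2 would have both leaves 0 and 1 as neighbours in E
      ¬abc : ¬ (T a × T b × T c)
      ¬abc (ta , tb , tc) = 1+n≰n (≤-trans (two a b ta tb) (dE (suc (suc zero)) tc))
        where
        two : ∀ a b → T a → T b → 2 ≤ χ (a ∧ true) + (χ (b ∧ true) + (χ (c ∧ false) + count (λ i → lookup E' i ∧ isV x i)))
        two true true _ _ = s≤s (s≤s z≤n)

≅-twoThirds : ∀ {n m} {G : Graph n} {H : Graph m} → G ≅ H → TwoThirds G → TwoThirds H
≅-twoThirds {n} {m} {G} {H} G≅H ((DG , dG , eG) , upperG) = (DH , dH , trans (cong (3 *_) ∣DH∣≡∣DG∣) (trans eG (cong (2 *_) n≡m))) , upperH
  where
  π : Fin n ↔ Fin m
  π = _≅_.bij G≅H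
  to : Fin n → Fin m
  to = Inverse.to π
  from : Fin m → Fin n
  from = Inverse.from π
  pres : ∀ u v → adj G u v ≡ adj H (to u) (to v)
  pres = _≅_.pres G≅H
  n≡m : n ≡ m
  n≡m = ↔⇒≡ π
  pullback : Subset m → Subset n
  pullback E = tabulate (λ j → lookup E (to j))
  lookup-pullback : ∀ E j → lookup (pullback E) j ≡ lookup E (to j)
  lookup-pullback E j = lookup∘tabulate _ j
  ∣pullback∣ : ∀ E → ∣ pullback E ∣ ≡ ∣ E ∣
  ∣pullback∣ E = trans (∣∣≡count-≗ (pullback E) (λ j → lookup E (to j)) (lookup-pullback E)) (trans (sym (sum-permute (λ j → χ (lookup E j)) π)) (sym (∣∣≡count E)))
  degreeIn-pullback : ∀ E v → degreeIn G (pullback E) v ≡ degreeIn H E (to v)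
  degreeIn-pullback E v = trans (sum-cong-≗ (λ j → cong χ (cong₂ _∧_ (lookup-pullback E j) (pres v j)))) (sym (sum-permute (λ j → χ (lookup E j ∧ adj H (to v) j)) π))
  upperH : ∀ E → Dissociation H E → 3 * ∣ E ∣ ≤ 2 * m
  upperH E dE = subst₂ (λ a b → 3 * a ≤ 2 * b) (∣pullback∣ E) n≡m (upperG (pullback E) dpb)
    where
    dpb : Dissociation G (pullback E)
    dpb v t = subst (_≤ 1) (sym (degreeIn-pullback E v)) (dE (to v) (subst T (lookup-pullback E v) t))
  DH : Subset m
  DH = tabulate (λ w → lookup DG (from w))
  pullback-DH : ∀ j → lookup (pullback DH) j ≡ lookup DG j
  pullback-DH j = trans (lookup-pullback DH j) (trans (lookup∘tabulate _ (to j)) (cong (lookup DG) (Inverse.strictlyInverseʳ π j)))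
  ∣DH∣≡∣DG∣ : ∣ DH ∣ ≡ ∣ DG ∣
  ∣DH∣≡∣DG∣ = trans (sym (∣pullback∣ DH)) (trans (∣∣≡count (pullback DH)) (trans (count-cong pullback-DH) (sym (∣∣≡count DG))))
  dH : Dissociation H DH
  dH w t = subst (_≤ 1) eq (dG (from w) (subst T (lookup∘tabulate _ w) t))
    where
    eq : degreeIn G DG (from w) ≡ degreeIn H DH w
    eq = trans (sum-cong-≗ (λ j → cong χ (cong (_∧ adj G (from w) j) (sym (pullback-DH j))))) (trans (degreeIn-pullback DH (from w)) (cong (degreeIn H DH) (Inverse.strictlyInverseˡ π w)))

InT⇒twoThirds : ∀ {n} {G : Graph n} → InT G → TwoThirds G
InT⇒twoThirds base = P3-twoThirds
InT⇒twoThirds (op1 {G = G} t x) = O1-twoThirds G x (InT⇒twoThirds t)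
InT⇒twoThirds (op2 {G = G} t x) = O2-twoThirds G x (InT⇒twoThirds t)
InT⇒twoThirds (iso t i) = ≅-twoThirds i (InT⇒twoThirds t)

-- A vertex with three bad branches contradicts diss = 2n/3

module Dissociations {n} (G : Graph n) (tr : IsTree G) where

  open Branches G tr
  open IsTree tr

  MaxDeg≤1 : (Fin n → Bool) → Set
  MaxDeg≤1 D = ∀ v a b → T (D v) → T (D a) → Adj G v a → T (D b) → Adj G v b → a ≡ b

  maxDeg≤1⇒dissociation : ∀ D → MaxDeg≤1 D → Dissociation G (tabulate D)
  maxDeg≤1⇒dissociation D md v t = subst (_≤ 1) (sym (count-cong (λ i → cong (_∧ adj G v i) (lookup∘tabulate D i)))) (count≤1 _ unique)
    where
    tv : T (D v)
    tv = subst T (lookup∘tabulate D v) t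
    unique : ∀ a b → T (D a ∧ adj G v a) → T (D b ∧ adj G v b) → a ≡ b
    unique a b ta tb = md v a b tv (T∧₁ ta) (T∧₂ {D a} ta) (T∧₁ tb) (T∧₂ {D b} tb)

  record InBranch (y z : Fin n) : Set where
    field
      D : Fin n → Bool
      ⊆branch : ∀ v → T (D v) → T (branch y z v)
      maxDeg≤1 : MaxDeg≤1 D

  open InBranch

  ∅ : ∀ {y z} → InBranch y z
  ∅ = record { D = λ _ → false ; ⊆branch = λ v () ; maxDeg≤1 = λ v a b () }

  totalise : ∀ {y z} (b : Bool) → (T b → InBranch y z) → InBranch y z
  totalise true f = f tt
  totalise false f = ∅

  totalise-T : ∀ {y z} (b : Bool) (f : T b → InBranch y z) (t : T b) → totalise b f ≡ f t
  totalise-T true f t = refl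

  ∣_∣ᵇ : ∀ {y z} → InBranch y z → ℕ
  ∣ C ∣ᵇ = count (D C)

  -- Distinct branches at z are disjoint and non-adjacent, so in the union U only
  -- the root z can create new adjacencies.
  module Union (z : Fin n) (c : Fin n → Bool) (c⇒adj : ∀ w → T (c w) → Adj G z w)
               (S : ∀ w → T (c w) → InBranch z w) (withRoot : Bool)
               (rootOK : T withRoot → ∀ w t → T (D (S w t) w) →
                  (∀ w' t' → T (D (S w' t') w') → w' ≡ w) × (∀ a → T (D (S w t) a) → ¬ Adj G w a)) where

    Ŝ : ∀ w → InBranch z w
    Ŝ w = totalise (c w) (S w)

    Ŝ⇒S : ∀ {w v} (t : T (c w)) → T (D (Ŝ w) v) → T (D (S w t) v)
    Ŝ⇒S {w} {v} t = subst (λ C → T (D C v)) (totalise-T (c w) (S w) t)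

    inSome : Fin n → Bool
    inSome v = some (λ w → c w ∧ D (Ŝ w) v)

    U : Fin n → Bool
    U v = (withRoot ∧ (v == z)) ∨ inSome v

    owner-unique : ∀ {w w' v} → T (c w) → T (D (Ŝ w) v) → T (c w') → T (D (Ŝ w') v) → w ≡ w'
    owner-unique cw t cw' t' = branch-unique (c⇒adj _ cw) (c⇒adj _ cw') (⊆branch (Ŝ _) _ t) (⊆branch (Ŝ _) _ t')

    ∈U⁻ : ∀ {v} → T (U v) → (T withRoot × v ≡ z) ⊎ (∃ λ w → T (c w) × T (D (Ŝ w) v))
    ∈U⁻ {v} t with T∨-elim {withRoot ∧ (v == z)} t
    ... | inj₁ t₁ = inj₁ (T∧₁ t₁ , T-==⇒≡ (T∧₂ {withRoot} t₁))
    ... | inj₂ t₂ with some⁻ {p = λ w → c w ∧ D (Ŝ w) v} t₂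
    ...   | w , tw = inj₂ (w , T∧₁ tw , T∧₂ {c w} tw)

    root∈U : T withRoot → T (U z)
    root∈U t = T∨₁ (T∧ t (≡true⇒T (==-refl z)))

    root∈U⁻ : T (U z) → T withRoot
    root∈U⁻ t with ∈U⁻ t
    ... | inj₁ (r , _) = r
    ... | inj₂ (w , cw , tw) = ⊥-elim (branch⇒≢ (⊆branch (Ŝ w) _ tw) refl)

    ∈U∩branch : ∀ {w v} → T (c w) → T (branch z w v) → T (U v) → T (D (Ŝ w) v)
    ∈U∩branch {w} {v} cw b t with ∈U⁻ t
    ... | inj₁ (_ , refl) = ⊥-elim (branch⇒≢ b refl)
    ... | inj₂ (w' , cw' , tw') = subst (λ q → T (D (Ŝ q) v)) (branch-unique (c⇒adj _ cw') (c⇒adj _ cw) (⊆branch (Ŝ w') _ tw') b) tw'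

    ∣U∣ : count U ≡ χ withRoot + sumOver c (λ w → ∣ Ŝ w ∣ᵇ)
    ∣U∣ = trans (sum-cong-≗ split) (trans (∑-distrib-+ (λ v → χ (withRoot ∧ (v == z))) (λ v → count (λ w → c w ∧ D (Ŝ w) v)))
                (cong₂ _+_ (sum-χ-∧== z withRoot) (sum-count-swap c (λ w → D (Ŝ w)))))
      where
      at-most-one-owner : ∀ v → count (λ w → c w ∧ D (Ŝ w) v) ≤ 1
      at-most-one-owner v = count≤1 _ (λ a b ta tb → owner-unique (T∧₁ ta) (T∧₂ {c a} ta) (T∧₁ tb) (T∧₂ {c b} tb))
      split : ∀ v → χ (U v) ≡ χ (withRoot ∧ (v == z)) + count (λ w → c w ∧ D (Ŝ w) v)
      split v = trans (χ-∨ (withRoot ∧ (v == z)) (inSome v) disjoint) (cong (χ (withRoot ∧ (v == z)) +_) (χ-some _ (at-most-one-owner v)))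
        where
        disjoint : ¬ (T (withRoot ∧ (v == z)) × T (inSome v))
        disjoint (t₁ , t₂) with some⁻ {p = λ w → c w ∧ D (Ŝ w) v} t₂
        ... | w , tw = branch⇒≢ (⊆branch (Ŝ w) _ (T∧₂ {c w} tw)) (T-==⇒≡ (T∧₂ {withRoot} t₁))

    3*∣U∣-bound : ∀ f → (∀ w t → f w ≤ 3 * ∣ S w t ∣ᵇ) → 3 * χ withRoot + sumOver c f ≤ 3 * count U
    3*∣U∣-bound f h = begin
      3 * χ withRoot + sumOver c f                                 ≤⟨ +-monoʳ-≤ (3 * χ withRoot) (sumOver-mono c f _ h') ⟩
      3 * χ withRoot + sumOver c (λ w → 3 * ∣ Ŝ w ∣ᵇ)             ≡⟨ cong (3 * χ withRoot +_) (sumOver-* c 3 _) ⟩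
      3 * χ withRoot + 3 * sumOver c (λ w → ∣ Ŝ w ∣ᵇ)             ≡⟨ sym (*-distribˡ-+ 3 (χ withRoot) _) ⟩
      3 * (χ withRoot + sumOver c (λ w → ∣ Ŝ w ∣ᵇ))               ≡⟨ cong (3 *_) (sym ∣U∣) ⟩
      3 * count U                                                  ∎
      where
      open ≤-Reasoning
      h' : ∀ w → T (c w) → f w ≤ 3 * ∣ Ŝ w ∣ᵇ
      h' w t = subst (λ C → f w ≤ 3 * ∣ C ∣ᵇ) (sym (totalise-T (c w) (S w) t)) (h w t)

    nbr-of-root : ∀ {a} → T (U a) → Adj G z a → ∃ λ w → T (c w) × T (D (Ŝ w) w) × a ≡ w
    nbr-of-root {a} t e with ∈U⁻ t
    ... | inj₁ (_ , refl) = ⊥-elim (adj-irrefl G e)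
    ... | inj₂ (w , cw , tw) = w , cw , subst (λ q → T (D (Ŝ w) q)) a≡w tw , a≡w
      where
      a≡w : a ≡ w
      a≡w = sym (acyclic⇒neighbours-separated acyclic (c⇒adj _ cw) e (branch⇒walk (⊆branch (Ŝ w) _ tw)))

    root-isolated : (∀ w t → ¬ T (D (S w t) w)) → ∀ a → T (U a) → ¬ Adj G z a
    root-isolated h a t e with nbr-of-root t e
    ... | w , cw , tw , _ = h w cw (Ŝ⇒S cw tw)

    maxDeg≤1-U : MaxDeg≤1 U
    maxDeg≤1-U v a b tv ta ea tb eb with ∈U⁻ tv
    ... | inj₁ (r , refl) with nbr-of-root ta ea | nbr-of-root tb eb
    ...   | w , cw , tw , refl | w' , cw' , tw' , refl = sym (proj₁ (rootOK r w cw (Ŝ⇒S cw tw)) w' cw' (Ŝ⇒S cw' tw'))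
    maxDeg≤1-U v a b tv ta ea tb eb | inj₂ (w , cw , tw) = decide (a ≟ z) (b ≟ z)
      where
      v∈branch : T (branch z w v)
      v∈branch = ⊆branch (Ŝ w) _ tw
      in-Ŝ : ∀ {u} → T (U u) → Adj G v u → u ≢ z → T (D (Ŝ w) u)
      in-Ŝ tu e ne = ∈U∩branch cw (branch-step v∈branch e ne) tu
      -- If z ∈ U is adjacent to v, then v = w, and rootOK forbids a second U-neighbour of w.
      via-root : ∀ {u} → T (U z) → T (U u) → Adj G v u → u ≢ z → Adj G v z → ⊥
      via-root {u} tz tu e ne ez with sym (acyclic⇒neighbours-separated acyclic (c⇒adj _ cw) (adj-sym G ez) (branch⇒walk v∈branch))
      ... | refl = proj₂ (rootOK (root∈U⁻ tz) w cw (Ŝ⇒S cw tw)) u (Ŝ⇒S cw (in-Ŝ tu e ne)) e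
      decide : Dec (a ≡ z) → Dec (b ≡ z) → a ≡ b
      decide (yes a≡z) (yes b≡z) = trans a≡z (sym b≡z)
      decide (yes refl) (no b≢z) = ⊥-elim (via-root ta tb eb b≢z ea)
      decide (no a≢z) (yes refl) = ⊥-elim (via-root tb ta ea a≢z eb)
      decide (no a≢z) (no b≢z) = maxDeg≤1 (Ŝ w) v a b tw (in-Ŝ ta ea a≢z) ea (in-Ŝ tb eb b≢z) eb

    inBranch : ∀ {y} → Adj G y z → (∀ w → T (c w) → T (child y z w)) → InBranch y z
    inBranch e c⇒child = record { D = U ; ⊆branch = ⊆ ; maxDeg≤1 = maxDeg≤1-U }
      where
      ⊆ : ∀ v → T (U v) → T (branch _ z v)
      ⊆ v t with ∈U⁻ t
      ... | inj₁ (_ , refl) = branch-root e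
      ... | inj₂ (w , cw , tw) = branch-child⊆ e (c⇒child w cw) (⊆branch (Ŝ w) v tw)

  WithoutRoot IsolatedRoot Bounded : Fin n → Fin n → (ℕ → Set) → Set
  WithoutRoot y z P = Σ (InBranch y z) λ C → ¬ T (D C z) × P ∣ C ∣ᵇ
  IsolatedRoot y z P = Σ (InBranch y z) λ C → T (D C z) × (∀ a → T (D C a) → ¬ Adj G z a) × P ∣ C ∣ᵇ
  Bounded y z P = Σ (InBranch y z) λ C → P ∣ C ∣ᵇ

  -- The invariant of the bottom-up construction of dissociation sets.
  BranchBounds : Fin n → Fin n → Set
  BranchBounds y z =
    WithoutRoot y z (λ q → 2 * size y z ≤ 3 * q + 2) ×
    Bounded y z (λ q → 2 * size y z ≤ 3 * q) ×
    (mod3 (size y z) ≡ 1 → WithoutRoot y z (λ q → 2 * size y z ≤ 3 * q) ⊎ IsolatedRoot y z (λ q → 2 * size y z ≤ 3 * q))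

  module Extend {y z} (e : Adj G y z) (ih : ∀ w → T (child y z w) → BranchBounds z w) where

    c : Fin n → Bool
    c = child y z

    S R : ℕ
    S = sumOver c (size z)
    R = sumOver c (λ w → mod3 (size z w))

    2*size≡ : 2 * size y z ≡ 2 + 2 * S
    2*size≡ = trans (cong (2 *_) (size≡1+∑children e)) (*-distribˡ-+ 2 1 S)

    Family : Set
    Family = ∀ w → T (c w) → InBranch z w

    RootCompatible : Family → Set
    RootCompatible F = ∀ w t → T (D (F w t) w) → (∀ w' t' → T (D (F w' t') w') → w' ≡ w) × (∀ a → T (D (F w t) a) → ¬ Adj G w a)

    bounded : Family
    bounded w t = proj₁ (proj₁ (proj₂ (ih w t)))

    rootless : Family
    rootless w t = proj₁ (proj₁ (ih w t))

    rootless∌root : ∀ w t → ¬ T (D (rootless w t) w)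
    rootless∌root w t = proj₁ (proj₂ (proj₁ (ih w t)))

    module X = Union z c (λ w → child⇒adj) bounded false (λ ())

    X-set : InBranch y z
    X-set = X.inBranch e (λ w t → t)

    2S+R≤3∣X∣ : 2 * S + R ≤ 3 * ∣ X-set ∣ᵇ
    2S+R≤3∣X∣ = begin
      2 * S + R                                            ≡⟨ cong (_+ R) (sym (sumOver-* c 2 (size z))) ⟩
      sumOver c (λ w → 2 * size z w) + R                   ≡⟨ sym (sumOver-+ c _ _) ⟩
      sumOver c (λ w → 2 * size z w + mod3 (size z w))     ≤⟨ X.3*∣U∣-bound _ (λ w t → 2*+mod3≤ (size z w) ∣ bounded w t ∣ᵇ (proj₂ (proj₁ (proj₂ (ih w t))))) ⟩
      3 * ∣ X-set ∣ᵇ                                       ∎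
      where open ≤-Reasoning

    without-bound : WithoutRoot y z (λ q → 2 * size y z ≤ 3 * q + 2)
    without-bound = X-set , X.root∈U⁻ , ≤-trans (≤-reflexive (trans 2*size≡ (+-comm 2 (2 * S)))) (+-monoˡ-≤ 2 (≤-trans (m≤m+n (2 * S) R) 2S+R≤3∣X∣))

    2≤R⇒X : 2 ≤ R → 2 * size y z ≤ 3 * ∣ X-set ∣ᵇ
    2≤R⇒X 2≤R = ≤-trans (≤-reflexive (trans 2*size≡ (+-comm 2 (2 * S)))) (≤-trans (+-monoʳ-≤ (2 * S) 2≤R) 2S+R≤3∣X∣)

    module Y (F : Family) (ok : RootCompatible F) (bd : ∀ w t → 2 * size z w ≤ 3 * ∣ F w t ∣ᵇ) where
      open Union z c (λ w → child⇒adj) F true (λ _ → ok) public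

      Y-set : InBranch y z
      Y-set = inBranch e (λ w t → t)

      Y-bound : 2 * size y z ≤ 3 * ∣ Y-set ∣ᵇ
      Y-bound = begin
        2 * size y z                             ≡⟨ 2*size≡ ⟩
        2 + 2 * S                                ≤⟨ +-monoˡ-≤ (2 * S) (n≤1+n 2) ⟩
        3 + 2 * S                                ≡⟨ cong (3 +_) (sym (sumOver-* c 2 (size z))) ⟩
        3 + sumOver c (λ w → 2 * size z w)       ≤⟨ 3*∣U∣-bound _ bd ⟩
        3 * ∣ Y-set ∣ᵇ                           ∎
        where open ≤-Reasoning

      bounded-Y : Bounded y z (λ q → 2 * size y z ≤ 3 * q)
      bounded-Y = Y-set , Y-bound

    rootless-compatible : RootCompatible rootless
    rootless-compatible w t tw = ⊥-elim (rootless∌root w t tw)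

    rootless-bound : ∀ w t → mod3 (size z w) ≡ 0 → 2 * size z w ≤ 3 * ∣ rootless w t ∣ᵇ
    rootless-bound w t r = 2*≤-sharpen (size z w) ∣ rootless w t ∣ᵇ r (proj₂ (proj₂ (proj₁ (ih w t))))

    module R≡0 (R≡0 : R ≡ 0) where
      module Y₀ = Y rootless rootless-compatible (λ w t → rootless-bound w t (sumOver≡0⇒ c _ R≡0 w t))

      isolated : IsolatedRoot y z (λ q → 2 * size y z ≤ 3 * q)
      isolated = Y₀.Y-set , Y₀.root∈U tt , Y₀.root-isolated rootless∌root , Y₀.Y-bound

    -- Exactly one child j has a branch of order ≡ 1 (mod 3): use the third bound there.
    module R≡1 (R≡1 : R ≡ 1) where
      j : Fin n
      j = proj₁ (sumOver≡1⇒ c _ R≡1)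
      cj : T (c j)
      cj = proj₁ (proj₂ (sumOver≡1⇒ c _ R≡1))
      rj : mod3 (size z j) ≡ 1
      rj = proj₁ (proj₂ (proj₂ (sumOver≡1⇒ c _ R≡1)))
      others : ∀ w → T (c w) → w ≢ j → mod3 (size z w) ≡ 0
      others = proj₂ (proj₂ (proj₂ (sumOver≡1⇒ c _ R≡1)))

      replace : InBranch z j → Family
      replace C w t with w ≟ j
      ... | yes refl = C
      ... | no _ = rootless w t

      replace-bound : ∀ C → 2 * size z j ≤ 3 * ∣ C ∣ᵇ → ∀ w t → 2 * size z w ≤ 3 * ∣ replace C w t ∣ᵇ
      replace-bound C b w t with w ≟ j
      ... | yes refl = b
      ... | no w≢j = rootless-bound w t (others w t w≢j)

      replace-root : ∀ C w t → T (D (replace C w t) w) → w ≡ j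
      replace-root C w t tw with w ≟ j
      ... | yes w≡j = w≡j
      ... | no _ = ⊥-elim (rootless∌root w t tw)

      compatible-without : ∀ C → ¬ T (D C j) → RootCompatible (replace C)
      compatible-without C j∉C w t tw with w ≟ j
      ... | yes refl = ⊥-elim (j∉C tw)
      ... | no _ = ⊥-elim (rootless∌root w t tw)

      compatible-isolated : ∀ C → (∀ a → T (D C a) → ¬ Adj G j a) → RootCompatible (replace C)
      compatible-isolated C isolated w t tw with w ≟ j
      ... | no _ = ⊥-elim (rootless∌root w t tw)
      ... | yes refl = (λ w' t' tw' → replace-root C w' t' tw') , isolated

      bounded-1 : Bounded y z (λ q → 2 * size y z ≤ 3 * q)
      bounded-1 with proj₂ (proj₂ (ih j cj)) rj
      ... | inj₁ (C , j∉C , b) = Y.bounded-Y (replace C) (compatible-without C j∉C) (replace-bound C b)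
      ... | inj₂ (C , _ , isolated , b) = Y.bounded-Y (replace C) (compatible-isolated C isolated) (replace-bound C b)

    mod3-S≡mod3-R : mod3 S ≡ mod3 R
    mod3-S≡mod3-R = mod3-sum _ _ (λ w → mod3-when (c w) (size z w))

    bounded-part : Bounded y z (λ q → 2 * size y z ≤ 3 * q)
    bounded-part with 2 ≤? R
    ... | yes 2≤R = X-set , 2≤R⇒X 2≤R
    ... | no R<2 with R in eR
    ...   | 0 = Y.bounded-Y rootless rootless-compatible (λ w t → rootless-bound w t (sumOver≡0⇒ c _ eR w t))
    ...   | 1 = R≡1.bounded-1 eR
    ...   | suc (suc _) = ⊥-elim (R<2 (s≤s (s≤s z≤n)))

    residue1-part : mod3 (size y z) ≡ 1 → WithoutRoot y z (λ q → 2 * size y z ≤ 3 * q) ⊎ IsolatedRoot y z (λ q → 2 * size y z ≤ 3 * q)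
    residue1-part r with 2 ≤? R
    ... | yes 2≤R = inj₁ (X-set , X.root∈U⁻ , 2≤R⇒X 2≤R)
    ... | no R<2 with R in eR
    ...   | 0 = inj₂ (R≡0.isolated eR)
    ...   | 1 = ⊥-elim (0≢1+n (trans (sym mod3-S≡0) (trans mod3-S≡mod3-R (cong mod3 eR))))
      where
      mod3-S≡0 : mod3 S ≡ 0
      mod3-S≡0 = mod3-pred {S} (trans (cong mod3 (sym (size≡1+∑children e))) r)
    ...   | suc (suc _) = ⊥-elim (R<2 (s≤s (s≤s z≤n)))

    bounds : BranchBounds y z
    bounds = without-bound , bounded-part , residue1-part

  branchBounds : ∀ {y z} → Adj G y z → BranchBounds y z
  branchBounds {y} {z} e = go (size y z) e ≤-refl
    where
    go : ∀ k {y z} → Adj G y z → size y z ≤ k → BranchBounds y z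
    go zero e le = ⊥-elim (1+n≰n (≤-trans (1≤size e) le))
    go (suc k) e le = Extend.bounds e (λ w t → go k (child⇒adj t) (≤-pred (≤-trans (size-child< e t) le)))

  -- Each bad branch at y contributes a positive residue to the rounded bound.
  twoThirds⇒fewBad : ∀ {k} → IsDissNumber G k → 3 * k ≡ 2 * n → ∀ y → FewBad y
  twoThirds⇒fewBad {k} dn e y with 3 ≤? count (badNeighbour y)
  ... | no ≱3 = ≤-pred (≰⇒> ≱3)
  ... | yes ≥3 = ⊥-elim (1+n≰n (≤-trans lower upper))
    where
    c : Fin n → Bool
    c = adj G y
    bounded : ∀ w → T (c w) → Bounded y w (λ q → 2 * size y w ≤ 3 * q)
    bounded w t = proj₁ (proj₂ (branchBounds t))
    module X = Union y c (λ w t → t) (λ w t → proj₁ (bounded w t)) false (λ ())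
    upper : 3 * count X.U ≤ 2 * n
    upper = subst (λ q → 3 * q ≤ 2 * n) (∣tabulate∣ X.U) (diss⇒upper {G = G} dn e (tabulate X.U) (maxDeg≤1⇒dissociation X.U X.maxDeg≤1-U))
    R : ℕ
    R = sumOver c (λ w → mod3 (size y w))
    3≤R : 3 ≤ R
    3≤R = ≤-trans ≥3 (sum-mono pointwise)
      where
      pointwise : ∀ w → χ (badNeighbour y w) ≤ when (c w) (mod3 (size y w))
      pointwise w with adj G y w
      ... | false = z≤n
      ... | true with mod3 (size y w)
      ...   | zero = z≤n
      ...   | suc _ = s≤s z≤n
    lower : suc (2 * n) ≤ 3 * count X.U
    lower = begin
      suc (2 * n)                                        ≡⟨ cong (λ q → suc (2 * q)) (n≡1+∑branches y) ⟩
      suc (2 * suc (sumOver c (size y)))                 ≡⟨ cong suc (*-distribˡ-+ 2 1 _) ⟩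
      3 + 2 * sumOver c (size y)                         ≤⟨ +-monoˡ-≤ _ 3≤R ⟩
      R + 2 * sumOver c (size y)                         ≡⟨ +-comm R _ ⟩
      2 * sumOver c (size y) + R                         ≡⟨ cong (_+ R) (sym (sumOver-* c 2 (size y))) ⟩
      sumOver c (λ w → 2 * size y w) + R                 ≡⟨ sym (sumOver-+ c _ _) ⟩
      sumOver c (λ w → 2 * size y w + mod3 (size y w))   ≤⟨ X.3*∣U∣-bound _ (λ w t → 2*+mod3≤ (size y w) ∣ proj₁ (bounded w t) ∣ᵇ (proj₂ (bounded w t))) ⟩
      3 * count X.U                                      ∎
      where open ≤-Reasoning

-- Descent to a branch of order 3

≤1-cases : ∀ k → k ≤ 1 → k ≡ 0 ⊎ k ≡ 1
≤1-cases 0 _ = inj₁ refl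
≤1-cases 1 _ = inj₂ refl
≤1-cases (suc (suc k)) (s≤s ())

≤2-cases : ∀ k → k ≤ 2 → k ≡ 0 ⊎ k ≡ 1 ⊎ k ≡ 2
≤2-cases 0 _ = inj₁ refl
≤2-cases 1 _ = inj₂ (inj₁ refl)
≤2-cases 2 _ = inj₂ (inj₂ refl)
≤2-cases (suc (suc (suc k))) (s≤s (s≤s ()))

-- A pendant path u - v - w attached at p (the shape removed by O1).
record O1Shape {n} (G : Graph n) : Set where
  field
    u v w p : Fin n
    uv : Adj G u v
    vw : Adj G v w
    wp : Adj G w p
    Nu : ∀ t → Adj G u t → t ≡ v
    Nv : ∀ t → Adj G v t → t ≡ u ⊎ t ≡ w
    Nw : ∀ t → Adj G w t → t ≡ v ⊎ t ≡ p
    u≢w : u ≢ w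
    u≢p : u ≢ p
    v≢p : v ≢ p

-- A pendant star u - v - u' attached at p through its centre v (the shape removed by O2).
record O2Shape {n} (G : Graph n) : Set where
  field
    u u' v p : Fin n
    uv : Adj G u v
    u'v : Adj G u' v
    vp : Adj G v p
    Nu : ∀ t → Adj G u t → t ≡ v
    Nu' : ∀ t → Adj G u' t → t ≡ v
    Nv : ∀ t → Adj G v t → t ≡ u ⊎ t ≡ u' ⊎ t ≡ p
    u≢u' : u ≢ u'
    u≢p : u ≢ p
    u'≢p : u' ≢ p

module Descent {n} (G : Graph n) (tr : IsTree G) (n≡0 : mod3 n ≡ 0) (few : ∀ y → Branches.FewBad G tr y) where

  open Branches G tr

  ZeroBranchBelow : ℕ → Set
  ZeroBranchBelow k = ∃₂ λ a b → Adj G a b × mod3 (size a b) ≡ 0 × size a b < k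

  below-mono : ∀ {k k'} → k ≤ k' → ZeroBranchBelow k → ZeroBranchBelow k'
  below-mono le (a , b , e , r , l) = a , b , e , r , <-≤-trans l le

  ∑children : Fin n → Fin n → ℕ
  ∑children y z = sumOver (child y z) (size z)

  parent-bad : ∀ {y z} → Adj G y z → mod3 (size y z) ≢ 0 → T (bad z y)
  parent-bad {y} {z} e r≢0 = bad⁺ (λ r → r≢0 (begin
    mod3 (size y z)                        ≡⟨ cong (λ k → mod3 (k + size y z)) (sym r) ⟩
    mod3 (mod3 (size z y) + size y z)      ≡⟨ sym (mod3-+ˡ (size z y) (size y z)) ⟩
    mod3 (size z y + size y z)             ≡⟨ cong mod3 (trans (+-comm (size z y) (size y z)) (size+size≡n e)) ⟩
    mod3 n                                 ≡⟨ n≡0 ⟩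
    0                                      ∎))
    where open ≡-Reasoning

  zero-child-or-bad-children : ∀ {y z} → Adj G y z →
    ZeroBranchBelow (size y z) ⊎ ((∀ w → T (child y z w) → T (bad z w)) × count (child y z) + χ (bad z y) ≤ 2)
  zero-child-or-bad-children {y} {z} e with any? (λ w → T? (child y z w) ×-dec (mod3 (size z w) ≟ℕ 0))
  ... | yes (w , c , r) = inj₁ (z , w , child⇒adj c , r , size-child< e c)
  ... | no none = inj₂ (all-bad , children+parent≤2)
    where
    all-bad : ∀ w → T (child y z w) → T (bad z w)
    all-bad w c = bad⁺ (λ r → none (w , c , r))
    child⇒badNeighbour : ∀ w → T (child y z w) → T (badNeighbour z w)
    child⇒badNeighbour w c = T∧ (child⇒adj c) (all-bad w c)
    children+parent≤2 : count (child y z) + χ (bad z y) ≤ 2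
    children+parent≤2 with bad z y in eb
    ... | false = subst (_≤ 2) (sym (+-identityʳ _)) (≤-trans (count-mono _ _ child⇒badNeighbour) (few z))
    ... | true = subst (_≤ 2) (+-comm 1 _) (≤-trans (s≤s (count-mono _ _ child⇒other-bad)) (subst (_≤ 2) (count-remove y (badNeighbour z) parent) (few z)))
      where
      parent : T (badNeighbour z y)
      parent = T∧ (adj-sym G e) (subst T (sym eb) tt)
      child⇒other-bad : ∀ w → T (child y z w) → T (remove y (badNeighbour z) w)
      child⇒other-bad w c = remove⁺ {p = badNeighbour z} (child⇒badNeighbour w c) (child⇒≢ c)

  at-most-one-child : ∀ {y z} → Adj G y z → mod3 (size y z) ≢ 0 → count (child y z) + χ (bad z y) ≤ 2 → count (child y z) ≤ 1
  at-most-one-child {y} {z} e r≢0 le = ≤-pred (subst (_≤ 2) (trans (cong (count (child y z) +_) (χ≡1 (parent-bad e r≢0))) (+-comm (count (child y z)) 1)) le)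

  residue1 : ∀ {y z} → Adj G y z → mod3 (size y z) ≡ 1 → ZeroBranchBelow (size y z) ⊎ size y z ≡ 1
  residue1 {y} {z} e r with zero-child-or-bad-children e
  ... | inj₁ below = inj₁ below
  ... | inj₂ (all-bad , le) with ≤1-cases (count (child y z)) (at-most-one-child e (λ r0 → 0≢1+n (trans (sym r0) r)) le)
  ...   | inj₁ c0 = inj₂ (trans (size≡1+∑children e) (cong suc (sumOver-count0 (child y z) (size z) c0)))
  ...   | inj₂ c1 with sumOver-count1 (child y z) (size z) c1
  ...     | j , cj , _ , ∑≡ = ⊥-elim (bad⁻ (all-bad j cj) (mod3-pred {size z j} (trans (cong mod3 (trans (cong suc (sym ∑≡)) (sym (size≡1+∑children e)))) r)))

  residue2 : ∀ {y z} → Adj G y z → mod3 (size y z) ≡ 2 → ZeroBranchBelow (size y z) ⊎ size y z ≡ 2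
  residue2 {y} {z} e r with zero-child-or-bad-children e
  ... | inj₁ below = inj₁ below
  ... | inj₂ (all-bad , le) with ≤1-cases (count (child y z)) (at-most-one-child e (λ r0 → 0≢1+n (trans (sym r0) r)) le)
  ...   | inj₁ c0 = contradiction (trans (sym r) (cong mod3 (trans (size≡1+∑children e) (cong suc (sumOver-count0 (child y z) (size z) c0))))) λ ()
  ...   | inj₂ c1 with sumOver-count1 (child y z) (size z) c1
  ...     | j , cj , _ , ∑≡ with residue1 (child⇒adj cj) (mod3-pred {size z j} (trans (cong mod3 (trans (cong suc (sym ∑≡)) (sym (size≡1+∑children e)))) r))
  ...       | inj₁ below = inj₁ (below-mono (<⇒≤ (size-child< e cj)) below)
  ...       | inj₂ s≡1 = inj₂ (trans (size≡1+∑children e) (cong suc (trans ∑≡ s≡1)))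

  residue0-total : ∀ z (c : Fin n → Bool) → (∀ w → T (c w) → Adj G z w) → (∀ w → T (c w) → T (bad z w)) → count c ≤ 2 →
    mod3 (suc (sumOver c (size z))) ≡ 0 → ZeroBranchBelow (suc (sumOver c (size z))) ⊎ suc (sumOver c (size z)) ≡ 3
  residue0-total z c c⇒adj all-bad le r with ≤2-cases (count c) le
  ... | inj₁ c0 = contradiction (trans (sym r) (cong (λ k → mod3 (suc k)) (sumOver-count0 c (size z) c0))) λ ()
  ... | inj₂ (inj₁ c1) with sumOver-count1 c (size z) c1
  ...   | j , cj , _ , ∑≡ with residue2 (c⇒adj j cj) (mod3-pred {size z j} (trans (cong (λ k → mod3 (suc k)) (sym ∑≡)) r))
  ...     | inj₁ below = inj₁ (below-mono (m≤n⇒m≤1+n (≤-sumOver c (size z) j cj)) below)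
  ...     | inj₂ s≡2 = inj₂ (cong suc (trans ∑≡ s≡2))
  residue0-total z c c⇒adj all-bad le r | inj₂ (inj₂ c2) with sumOver-count2 c (size z) c2
  ... | j₁ , j₂ , _ , c₁ , c₂ , _ , ∑≡ with mod3-sum≡2 (size z j₁) (size z j₂) (bad⁻ (all-bad j₁ c₁)) (bad⁻ (all-bad j₂ c₂)) (mod3-pred {size z j₁ + size z j₂} (trans (cong (λ k → mod3 (suc k)) (sym ∑≡)) r))
  ...   | r₁ , r₂ with residue1 (c⇒adj j₁ c₁) r₁ | residue1 (c⇒adj j₂ c₂) r₂
  ...     | inj₁ below | _ = inj₁ (below-mono (m≤n⇒m≤1+n (≤-sumOver c (size z) j₁ c₁)) below)
  ...     | inj₂ _ | inj₁ below = inj₁ (below-mono (m≤n⇒m≤1+n (≤-sumOver c (size z) j₂ c₂)) below)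
  ...     | inj₂ s₁≡1 | inj₂ s₂≡1 = inj₂ (cong suc (trans ∑≡ (cong₂ _+_ s₁≡1 s₂≡1)))

  residue0 : ∀ {y z} → Adj G y z → mod3 (size y z) ≡ 0 → ZeroBranchBelow (size y z) ⊎ size y z ≡ 3
  residue0 {y} {z} e r with zero-child-or-bad-children e
  ... | inj₁ below = inj₁ below
  ... | inj₂ (all-bad , le) = subst (λ k → ZeroBranchBelow k ⊎ k ≡ 3) (sym (size≡1+∑children e))
          (residue0-total z (child y z) (λ w → child⇒adj) all-bad (≤-trans (m≤m+n _ _) le) (trans (cong mod3 (sym (size≡1+∑children e))) r))

  zero-branch⇒size3 : ∀ {y z} → Adj G y z → mod3 (size y z) ≡ 0 → ∃₂ λ p q → Adj G p q × size p q ≡ 3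
  zero-branch⇒size3 {y} {z} e r = go (size y z) e ≤-refl r
    where
    go : ∀ k {y z} → Adj G y z → size y z ≤ k → mod3 (size y z) ≡ 0 → ∃₂ λ p q → Adj G p q × size p q ≡ 3
    go zero e le r = ⊥-elim (1+n≰n (≤-trans (1≤size e) le))
    go (suc k) {y} {z} e le r with residue0 e r
    ... | inj₂ s≡3 = y , z , e , s≡3
    ... | inj₁ (a , b , e' , r' , l) = go k e' (≤-pred (≤-trans l le)) r'

  size3-branch : Fin n → n ≢ 3 → ∃₂ λ p q → Adj G p q × size p q ≡ 3
  size3-branch r n≢3 with any? (λ z → T? (adj G r z) ×-dec (mod3 (size r z) ≟ℕ 0))
  ... | yes (z , e , r0) = zero-branch⇒size3 e r0
  ... | no none with residue0-total r (adj G r) (λ _ t → t) all-bad (≤-trans (count-mono _ _ adj⇒bad) (few r)) (subst (λ k → mod3 k ≡ 0) (n≡1+∑branches r) n≡0)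
    where
    all-bad : ∀ w → T (adj G r w) → T (bad r w)
    all-bad w e = bad⁺ (λ q → none (w , e , q))
    adj⇒bad : ∀ w → T (adj G r w) → T (badNeighbour r w)
    adj⇒bad w e = T∧ e (all-bad w e)
  ...   | inj₁ (a , b , e , r0 , _) = zero-branch⇒size3 e r0
  ...   | inj₂ n≡3 = ⊥-elim (n≢3 (trans (n≡1+∑branches r) n≡3))

  size1⇒leaf : ∀ {y z} → Adj G y z → size y z ≡ 1 → ∀ u → Adj G z u → u ≡ y
  size1⇒leaf e s≡1 u eu with adj⇒parent-or-child eu
  ... | inj₁ u≡y = u≡y
  ... | inj₂ c = ⊥-elim (1+n≰n (subst (2 ≤_) s≡1 (≤-trans (s≤s (1≤size (child⇒adj c))) (size-child< e c))))

  count-children≤ : ∀ {y z} → Adj G y z → count (child y z) ≤ ∑children y z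
  count-children≤ {y} {z} e = count≤sumOver (child y z) (size z) (λ w c → 1≤size (child⇒adj c))

  ∑children≡ : ∀ {y z k} → Adj G y z → size y z ≡ suc k → ∑children y z ≡ k
  ∑children≡ e s≡ = suc-injective (trans (sym (size≡1+∑children e)) s≡)

  size2⇒leaf-child : ∀ {y z} → Adj G y z → size y z ≡ 2 →
    ∃ λ x → T (child y z x) × size z x ≡ 1 × (∀ u → T (child y z u) → u ≡ x)
  size2⇒leaf-child {y} {z} e s≡2 with ≤2-cases (count (child y z)) (≤-trans (count-children≤ e) (≤-trans (≤-reflexive (∑children≡ e s≡2)) (s≤s z≤n)))
  ... | inj₁ c0 = ⊥-elim (0≢1+n (trans (sym (sumOver-count0 (child y z) (size z) c0)) (∑children≡ e s≡2)))
  ... | inj₂ (inj₁ c1) with sumOver-count1 (child y z) (size z) c1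
  ...   | x , cx , unique , ∑≡ = x , cx , trans (sym ∑≡) (∑children≡ e s≡2) , unique
  size2⇒leaf-child e s≡2 | inj₂ (inj₂ c2) = ⊥-elim (1+n≰n (≤-trans (≤-reflexive (sym c2)) (≤-trans (count-children≤ e) (≤-reflexive (∑children≡ e s≡2)))))

  size3-shape : ∀ {p q} → Adj G p q → size p q ≡ 3 → O1Shape G ⊎ O2Shape G
  size3-shape {p} {q} e s≡3 with ≤2-cases (count (child p q)) (≤-trans (count-children≤ e) (≤-reflexive (∑children≡ e s≡3)))
  ... | inj₁ c0 = ⊥-elim (0≢1+n (trans (sym (sumOver-count0 (child p q) (size q) c0)) (∑children≡ e s≡3)))
  ... | inj₂ (inj₁ c1) with sumOver-count1 (child p q) (size q) c1
  ...   | j , cj , unique-j , ∑≡ with size2⇒leaf-child (child⇒adj cj) (trans (sym ∑≡) (∑children≡ e s≡3))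
  ...     | x , cx , sx , unique-x = inj₁ record
      { u = x ; v = j ; w = q ; p = p
      ; uv = adj-sym G (child⇒adj cx) ; vw = adj-sym G (child⇒adj cj) ; wp = adj-sym G e
      ; Nu = size1⇒leaf (child⇒adj cx) sx
      ; Nv = λ t et → [ inj₂ , (λ c → inj₁ (unique-x t c)) ]′ (adj⇒parent-or-child et)
      ; Nw = λ t et → [ inj₂ , (λ c → inj₁ (unique-j t c)) ]′ (adj⇒parent-or-child et)
      ; u≢w = child⇒≢ cx
      ; u≢p = λ x≡p → adj⇒≢ G (child⇒adj cj) (size1⇒leaf (child⇒adj cx) sx q (subst (λ t → Adj G t q) (sym x≡p) e))
      ; v≢p = child⇒≢ cj }
  size3-shape {p} {q} e s≡3 | inj₂ (inj₂ c2) with sumOver-count2 (child p q) (size q) c2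
  ... | j₁ , j₂ , j₁≢j₂ , c₁ , c₂ , j₁-or-j₂ , ∑≡ with +≡2⇒1,1 (1≤size (child⇒adj c₁)) (1≤size (child⇒adj c₂)) (trans (sym ∑≡) (∑children≡ e s≡3))
    where
    +≡2⇒1,1 : ∀ {a b : ℕ} → 1 ≤ a → 1 ≤ b → a + b ≡ 2 → a ≡ 1 × b ≡ 1
    +≡2⇒1,1 {1} {1} _ _ _ = refl , refl
    +≡2⇒1,1 {1} {suc (suc b)} _ _ ()
    +≡2⇒1,1 {suc (suc a)} {suc b} _ _ eq = ⊥-elim (1+n≢0 (trans (sym (+-suc a b)) (suc-injective (suc-injective eq))))
  ...   | s₁ , s₂ = inj₂ record
      { u = j₁ ; u' = j₂ ; v = q ; p = p
      ; uv = adj-sym G (child⇒adj c₁) ; u'v = adj-sym G (child⇒adj c₂) ; vp = adj-sym G e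
      ; Nu = size1⇒leaf (child⇒adj c₁) s₁ ; Nu' = size1⇒leaf (child⇒adj c₂) s₂
      ; Nv = λ t et → [ (λ t≡p → inj₂ (inj₂ t≡p)) , (λ c → [ inj₁ , (λ t≡j₂ → inj₂ (inj₁ t≡j₂)) ]′ (j₁-or-j₂ t c)) ]′ (adj⇒parent-or-child et)
      ; u≢u' = j₁≢j₂ ; u≢p = child⇒≢ c₁ ; u'≢p = child⇒≢ c₂ }

transpose-ˡ : ∀ {k} (a b : Fin k) → transpose a b ⟨$⟩ʳ a ≡ b
transpose-ˡ a b with a ≟ a
... | yes _ = refl
... | no ne = ⊥-elim (ne refl)

transpose-other : ∀ {k} (a b : Fin k) {t} → t ≢ a → t ≢ b → transpose a b ⟨$⟩ʳ t ≡ t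
transpose-other a b {t} t≢a t≢b with t ≟ a
... | yes e = ⊥-elim (t≢a e)
... | no _ with t ≟ b
...   | yes e = ⊥-elim (t≢b e)
...   | no _ = refl

module ToFront {m} (a b c : Fin (3 + m)) (a≢b : a ≢ b) (a≢c : a ≢ c) (b≢c : b ≢ c) where

  private
    σ₁ σ₂ σ₃ : Permutation (3 + m) (3 + m)
    σ₁ = transpose zero a
    b' c' : Fin (3 + m)
    b' = σ₁ ⟨$⟩ˡ b
    σ₂ = transpose (suc zero) b'
    c' = σ₂ ⟨$⟩ˡ (σ₁ ⟨$⟩ˡ c)
    σ₃ = transpose (suc (suc zero)) c'

    b'≢0 : b' ≢ zero
    b'≢0 e = a≢b (trans (sym (transpose-ˡ zero a)) (trans (cong (σ₁ ⟨$⟩ʳ_) (sym e)) (inverseʳ σ₁ {b})))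

    σ₂0≡0 : σ₂ ⟨$⟩ʳ zero ≡ zero
    σ₂0≡0 = transpose-other (suc zero) b' (λ ()) (λ e → b'≢0 (sym e))

    c'≢0 : c' ≢ zero
    c'≢0 e = a≢c (trans (sym (transpose-ˡ zero a)) (trans (cong (σ₁ ⟨$⟩ʳ_) (trans (sym σ₂0≡0) (trans (cong (σ₂ ⟨$⟩ʳ_) (sym e)) (inverseʳ σ₂ {σ₁ ⟨$⟩ˡ c})))) (inverseʳ σ₁ {c})))

    c'≢1 : c' ≢ suc zero
    c'≢1 e = b≢c (trans (sym (inverseʳ σ₁ {b})) (trans (cong (σ₁ ⟨$⟩ʳ_) (trans (sym (transpose-ˡ (suc zero) b')) (trans (cong (σ₂ ⟨$⟩ʳ_) (sym e)) (inverseʳ σ₂ {σ₁ ⟨$⟩ˡ c})))) (inverseʳ σ₁ {c})))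

  opaque
    π : Permutation (3 + m) (3 + m)
    π = σ₃ ∘ₚ σ₂ ∘ₚ σ₁

  opaque
    unfolding π

    π0 : π ⟨$⟩ʳ zero ≡ a
    π0 = trans (cong (λ t → σ₁ ⟨$⟩ʳ (σ₂ ⟨$⟩ʳ t)) (transpose-other (suc (suc zero)) c' (λ ()) (λ e → c'≢0 (sym e)))) (trans (cong (σ₁ ⟨$⟩ʳ_) σ₂0≡0) (transpose-ˡ zero a))

    π1 : π ⟨$⟩ʳ suc zero ≡ b
    π1 = trans (cong (λ t → σ₁ ⟨$⟩ʳ (σ₂ ⟨$⟩ʳ t)) (transpose-other (suc (suc zero)) c' (λ ()) (λ e → c'≢1 (sym e)))) (trans (cong (σ₁ ⟨$⟩ʳ_) (transpose-ˡ (suc zero) b')) (inverseʳ σ₁ {b}))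

    π2 : π ⟨$⟩ʳ suc (suc zero) ≡ c
    π2 = trans (cong (λ t → σ₁ ⟨$⟩ʳ (σ₂ ⟨$⟩ʳ t)) (transpose-ˡ (suc (suc zero)) c')) (trans (cong (σ₁ ⟨$⟩ʳ_) (inverseʳ σ₂ {σ₁ ⟨$⟩ˡ c})) (inverseʳ σ₁ {c}))

isOldIndex : ∀ {m} → Fin (3 + m) → Bool
isOldIndex (suc (suc (suc _))) = true
isOldIndex _ = false

-- G on 3 + m vertices, relabelled by π so that π 0, π 1, π 2 are the "new"
-- vertices and π (3 + j) is the old vertex j of the remaining graph.
module Relabel {m} (G : Graph (3 + m)) (tr : IsTree G) (π : Permutation (3 + m) (3 + m)) where

  old : Fin m → Fin (3 + m)
  old j = π ⟨$⟩ʳ suc (suc (suc j))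

  old-injective : ∀ {i j} → old i ≡ old j → i ≡ j
  old-injective {i} {j} e with trans (sym (inverseˡ π)) (trans (cong (π ⟨$⟩ˡ_) e) (inverseˡ π))
  ... | refl = refl

  new₀ new₁ new₂ : Fin (3 + m)
  new₀ = π ⟨$⟩ʳ zero
  new₁ = π ⟨$⟩ʳ suc zero
  new₂ = π ⟨$⟩ʳ suc (suc zero)

  data View : Fin (3 + m) → Set where
    is-new₀ : View new₀
    is-new₁ : View new₁
    is-new₂ : View new₂
    is-old : ∀ j → View (old j)

  view : ∀ t → View t
  view t = subst View (inverseʳ π) (viewIndex (π ⟨$⟩ˡ t))
    where
    viewIndex : ∀ i → View (π ⟨$⟩ʳ i)
    viewIndex zero = is-new₀
    viewIndex (suc zero) = is-new₁
    viewIndex (suc (suc zero)) = is-new₂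
    viewIndex (suc (suc (suc j))) = is-old j

  isOld : Fin (3 + m) → Bool
  isOld t = isOldIndex (π ⟨$⟩ˡ t)

  isOld-old : ∀ j → T (isOld (old j))
  isOld-old j = subst (λ i → T (isOldIndex i)) (sym (inverseˡ π)) tt

  ¬isOld-new₀ : ¬ T (isOld new₀)
  ¬isOld-new₀ = subst (λ i → T (isOldIndex i)) (inverseˡ π)
  ¬isOld-new₁ : ¬ T (isOld new₁)
  ¬isOld-new₁ = subst (λ i → T (isOldIndex i)) (inverseˡ π)
  ¬isOld-new₂ : ¬ T (isOld new₂)
  ¬isOld-new₂ = subst (λ i → T (isOldIndex i)) (inverseˡ π)

  old≢new₀ : ∀ j → old j ≢ new₀
  old≢new₀ j e = ¬isOld-new₀ (subst (λ q → T (isOld q)) e (isOld-old j))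
  old≢new₁ : ∀ j → old j ≢ new₁
  old≢new₁ j e = ¬isOld-new₁ (subst (λ q → T (isOld q)) e (isOld-old j))
  old≢new₂ : ∀ j → old j ≢ new₂
  old≢new₂ j e = ¬isOld-new₂ (subst (λ q → T (isOld q)) e (isOld-old j))

  old-cover : ∀ t → t ≢ new₀ → t ≢ new₁ → t ≢ new₂ → ∃ λ j → old j ≡ t
  old-cover t = cover (view t)
    where
    cover : ∀ {t} → View t → t ≢ new₀ → t ≢ new₁ → t ≢ new₂ → ∃ λ j → old j ≡ t
    cover is-new₀ ne _ _ = ⊥-elim (ne refl)
    cover is-new₁ _ ne _ = ⊥-elim (ne refl)
    cover is-new₂ _ _ ne = ⊥-elim (ne refl)
    cover (is-old j) _ _ _ = j , refl

  rest : Graph m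
  rest = record { adj = λ i j → adj G (old i) (old j) ; sym = λ i j → Graph.sym G (old i) (old j) ; irrefl = λ i → irrefl G (old i) }

  module Pendant (x : Fin m)
                 (new₀-inside : ∀ j → ¬ Adj G new₀ (old j)) (new₁-inside : ∀ j → ¬ Adj G new₁ (old j))
                 (new₂-attached : ∀ j → Adj G new₂ (old j) → j ≡ x)
                 (new₂-old-x : Adj G new₂ (old x))
                 (new₀~new₂ : WalkIn G (λ v → not (isOld v)) new₀ new₂) (new₁~new₂ : WalkIn G (λ v → not (isOld v)) new₁ new₂) where

    open IsTree tr

    squashIndex : Fin (3 + m) → Fin m
    squashIndex (suc (suc (suc j))) = j
    squashIndex _ = x

    squash : Fin (3 + m) → Fin m
    squash t = squashIndex (π ⟨$⟩ˡ t)

    squash-old : ∀ j → squash (old j) ≡ j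
    squash-old j = cong squashIndex (inverseˡ π)

    squash-new₀ : squash new₀ ≡ x
    squash-new₀ = cong squashIndex (inverseˡ π)
    squash-new₁ : squash new₁ ≡ x
    squash-new₁ = cong squashIndex (inverseˡ π)
    squash-new₂ : squash new₂ ≡ x
    squash-new₂ = cong squashIndex (inverseˡ π)

    squash-edge : ∀ a b → Adj G a b → squash a ≡ squash b ⊎ Adj rest (squash a) (squash b)
    squash-edge a b = go (view a) (view b)
      where
      go : ∀ {a b} → View a → View b → Adj G a b → squash a ≡ squash b ⊎ Adj rest (squash a) (squash b)
      go is-new₀ (is-old j) e = ⊥-elim (new₀-inside j e)
      go is-new₁ (is-old j) e = ⊥-elim (new₁-inside j e)
      go is-new₂ (is-old j) e = inj₁ (trans squash-new₂ (trans (sym (new₂-attached j e)) (sym (squash-old j))))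
      go (is-old j) is-new₀ e = ⊥-elim (new₀-inside j (adj-sym G e))
      go (is-old j) is-new₁ e = ⊥-elim (new₁-inside j (adj-sym G e))
      go (is-old j) is-new₂ e = inj₁ (trans (squash-old j) (trans (new₂-attached j (adj-sym G e)) (sym squash-new₂)))
      go (is-old i) (is-old j) e = inj₂ (subst₂ (Adj rest) (sym (squash-old i)) (sym (squash-old j)) e)
      go is-new₀ is-new₀ _ = inj₁ refl
      go is-new₀ is-new₁ _ = inj₁ (trans squash-new₀ (sym squash-new₁))
      go is-new₀ is-new₂ _ = inj₁ (trans squash-new₀ (sym squash-new₂))
      go is-new₁ is-new₀ _ = inj₁ (trans squash-new₁ (sym squash-new₀))
      go is-new₁ is-new₁ _ = inj₁ refl
      go is-new₁ is-new₂ _ = inj₁ (trans squash-new₁ (sym squash-new₂))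
      go is-new₂ is-new₀ _ = inj₁ (trans squash-new₂ (sym squash-new₀))
      go is-new₂ is-new₁ _ = inj₁ (trans squash-new₂ (sym squash-new₁))
      go is-new₂ is-new₂ _ = inj₁ refl

    rest-tree : 1 ≤ m → IsTree rest
    rest-tree 1≤m = record { nonempty = 1≤m ; connected = connected' ; acyclic = acyclic' }
      where
      connected' : Connected rest
      connected' i j = subst₂ (Walk rest) (squash-old i) (squash-old j) (toWalk (project-walk squash squash-edge {λ _ → true} {λ _ → true} (λ _ _ → tt) (fromWalk (connected (old i) (old j)))))
      acyclic' : Acyclic rest
      acyclic' c = acyclic record { m = Cycle.m c ; vtx = λ i → old (Cycle.vtx c i) ; inj = λ e → Cycle.inj c (old-injective e) ; edges = Cycle.edges c ; close = Cycle.close c }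

    private
      adj≡true : ∀ {a b} → Adj G a b → true ≡ adj G a b
      adj≡true e = sym (T⇒≡true e)
      adj≡false : ∀ {a b} → ¬ Adj G a b → false ≡ adj G a b
      adj≡false ne = sym (¬T⇒≡false ne)
      irrefl≡ : ∀ a → false ≡ adj G a a
      irrefl≡ a = sym (irrefl G a)
      ¬adj-sym : ∀ {a b} → ¬ Adj G a b → ¬ Adj G b a
      ¬adj-sym ne e = ne (adj-sym G e)

    new₂-old : ∀ j → isV x j ≡ adj G new₂ (old j)
    new₂-old j with x ≟ j
    ... | yes refl = adj≡true new₂-old-x
    ... | no x≢j = adj≡false (λ e → x≢j (sym (new₂-attached j e)))

    old-new₂ : ∀ j → isV x j ≡ adj G (old j) new₂
    old-new₂ j = trans (new₂-old j) (Graph.sym G new₂ (old j))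

    O1-rest≅ : Adj G new₀ new₁ → Adj G new₁ new₂ → ¬ Adj G new₀ new₂ → O1 rest x ≅ G
    O1-rest≅ e₀₁ e₁₂ ¬e₀₂ = record { bij = π ; pres = pres }
      where
      pres : ∀ i j → o1adj rest x i j ≡ adj G (π ⟨$⟩ʳ i) (π ⟨$⟩ʳ j)
      pres zero zero = irrefl≡ _
      pres zero (suc zero) = adj≡true e₀₁
      pres zero (suc (suc zero)) = adj≡false ¬e₀₂
      pres zero (suc (suc (suc j))) = adj≡false (new₀-inside j)
      pres (suc zero) zero = adj≡true (adj-sym G e₀₁)
      pres (suc zero) (suc zero) = irrefl≡ _
      pres (suc zero) (suc (suc zero)) = adj≡true e₁₂
      pres (suc zero) (suc (suc (suc j))) = adj≡false (new₁-inside j)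
      pres (suc (suc zero)) zero = adj≡false (¬adj-sym ¬e₀₂)
      pres (suc (suc zero)) (suc zero) = adj≡true (adj-sym G e₁₂)
      pres (suc (suc zero)) (suc (suc zero)) = irrefl≡ _
      pres (suc (suc zero)) (suc (suc (suc j))) = new₂-old j
      pres (suc (suc (suc i))) zero = adj≡false (¬adj-sym (new₀-inside i))
      pres (suc (suc (suc i))) (suc zero) = adj≡false (¬adj-sym (new₁-inside i))
      pres (suc (suc (suc i))) (suc (suc zero)) = old-new₂ i
      pres (suc (suc (suc i))) (suc (suc (suc j))) = refl

    O2-rest≅ : ¬ Adj G new₀ new₁ → Adj G new₀ new₂ → Adj G new₁ new₂ → O2 rest x ≅ G
    O2-rest≅ ¬e₀₁ e₀₂ e₁₂ = record { bij = π ; pres = pres }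
      where
      pres : ∀ i j → o2adj rest x i j ≡ adj G (π ⟨$⟩ʳ i) (π ⟨$⟩ʳ j)
      pres zero zero = irrefl≡ _
      pres zero (suc zero) = adj≡false ¬e₀₁
      pres zero (suc (suc zero)) = adj≡true e₀₂
      pres zero (suc (suc (suc j))) = adj≡false (new₀-inside j)
      pres (suc zero) zero = adj≡false (¬adj-sym ¬e₀₁)
      pres (suc zero) (suc zero) = irrefl≡ _
      pres (suc zero) (suc (suc zero)) = adj≡true e₁₂
      pres (suc zero) (suc (suc (suc j))) = adj≡false (new₁-inside j)
      pres (suc (suc zero)) zero = adj≡true (adj-sym G e₀₂)
      pres (suc (suc zero)) (suc zero) = adj≡true (adj-sym G e₁₂)
      pres (suc (suc zero)) (suc (suc zero)) = irrefl≡ _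
      pres (suc (suc zero)) (suc (suc (suc j))) = new₂-old j
      pres (suc (suc (suc i))) zero = adj≡false (¬adj-sym (new₀-inside i))
      pres (suc (suc (suc i))) (suc zero) = adj≡false (¬adj-sym (new₁-inside i))
      pres (suc (suc (suc i))) (suc (suc zero)) = old-new₂ i
      pres (suc (suc (suc i))) (suc (suc (suc j))) = refl

    module _ (1≤m : 1 ≤ m) where

      module BG = Branches G tr
      module BR = Branches rest (rest-tree 1≤m)

      old-stays-old : ∀ {a v} → T (isOld a) → WalkIn G (avoid (old x)) a v → T (isOld v)
      old-stays-old oa (stop _) = oa
      old-stays-old {a} oa (move {b = b} t e w) = old-stays-old (next (view a) (view b) oa t e) w
        where
        next : ∀ {a b} → View a → View b → T (isOld a) → T (avoid (old x) a) → Adj G a b → T (isOld b)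
        next is-new₀ _ oa _ _ = ⊥-elim (¬isOld-new₀ oa)
        next is-new₁ _ oa _ _ = ⊥-elim (¬isOld-new₁ oa)
        next is-new₂ _ oa _ _ = ⊥-elim (¬isOld-new₂ oa)
        next (is-old j) is-new₀ _ _ e = ⊥-elim (new₀-inside j (adj-sym G e))
        next (is-old j) is-new₁ _ _ e = ⊥-elim (new₁-inside j (adj-sym G e))
        next (is-old j) is-new₂ _ t e = ⊥-elim (avoid⁻ t (cong old (new₂-attached j (adj-sym G e))))
        next (is-old j) (is-old k) _ _ _ = isOld-old k

      squash-avoid : ∀ y v → T (avoid (old y) v) → (x ≢ y ⊎ T (isOld v)) → T (avoid y (squash v))
      squash-avoid y v t h = go (view v) t h
        where
        via-x : ∀ {v} → squash v ≡ x → x ≢ y ⊎ T (isOld v) → ¬ T (isOld v) → T (avoid y (squash v))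
        via-x e (inj₁ x≢y) _ = subst (λ q → T (avoid y q)) (sym e) (avoid⁺ x≢y)
        via-x e (inj₂ o) ¬o = ⊥-elim (¬o o)
        go : ∀ {v} → View v → T (avoid (old y) v) → x ≢ y ⊎ T (isOld v) → T (avoid y (squash v))
        go is-new₀ _ h = via-x squash-new₀ h ¬isOld-new₀
        go is-new₁ _ h = via-x squash-new₁ h ¬isOld-new₁
        go is-new₂ _ h = via-x squash-new₂ h ¬isOld-new₂
        go (is-old j) t _ = subst (λ q → T (avoid y q)) (sym (squash-old j)) (avoid⁺ (λ e → avoid⁻ t (cong old e)))

      branch-rest : ∀ y z j → BG.branch (old y) (old z) (old j) ≡ BR.branch y z j
      branch-rest y z j = T-ext to from
        where
        from : T (BR.branch y z j) → T (BG.branch (old y) (old z) (old j))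
        from t = BG.walk⇒branch (map-walk old (λ _ _ e → e) (λ v tv → avoid⁺ (λ e → avoid⁻ tv (old-injective e))) (BR.branch⇒walk t))
        to : T (BG.branch (old y) (old z) (old j)) → T (BR.branch y z j)
        to t with x ≟ y
        ... | no x≢y = BR.walk⇒branch (subst₂ (WalkIn rest (avoid y)) (squash-old z) (squash-old j)
                         (project-walk squash squash-edge (λ v tv → squash-avoid y v tv (inj₁ x≢y)) (BG.branch⇒walk t)))
        ... | yes refl = BR.walk⇒branch (subst₂ (WalkIn rest (avoid x)) (squash-old z) (squash-old j)
                           (project-walk squash squash-edge {p' = avoid x} (λ v tv → squash-avoid x v (T∧₁ tv) (inj₂ (T∧₂ {avoid (old x) v} tv))) within-old))
          where
          within-old : WalkIn G (λ v → avoid (old x) v ∧ isOld v) (old z) (old j)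
          within-old = restrict {p = avoid (old x)} {q = isOld} (BG.branch⇒walk t) (λ v w → old-stays-old (isOld-old z) w)

      new-together : ∀ y z → BG.branch (old y) (old z) new₀ ≡ BG.branch (old y) (old z) new₂ × BG.branch (old y) (old z) new₁ ≡ BG.branch (old y) (old z) new₂
      new-together y z = T-ext (along new₀~new₂) (along (reverse new₀~new₂)) , T-ext (along new₁~new₂) (along (reverse new₁~new₂))
        where
        along : ∀ {a b} → WalkIn G (λ v → not (isOld v)) a b → T (BG.branch (old y) (old z) a) → T (BG.branch (old y) (old z) b)
        along w t = BG.walk⇒branch (BG.branch⇒walk t ++ʷ weaken (λ v nv → avoid⁺ (λ e → T-not⁻ nv (subst (λ q → T (isOld q)) (sym e) (isOld-old y)))) w)

      -- Removing the new vertices changes the order of a branch by 0 or 3.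
      mod3-size-rest : ∀ y z → mod3 (BG.size (old y) (old z)) ≡ mod3 (BR.size y z)
      mod3-size-rest y z = begin
        mod3 (BG.size (old y) (old z))                                              ≡⟨ cong mod3 (sum-permute (λ v → χ (b v)) π) ⟩
        mod3 (χ (b new₀) + (χ (b new₁) + (χ (b new₂) + sum (λ j → χ (b (old j))))))  ≡⟨ cong mod3 (cong₂ _+_ (cong χ b₀≡b₂) (cong₂ _+_ (cong χ b₁≡b₂) (cong (χ (b new₂) +_) (sum-cong-≗ (λ j → cong χ (branch-rest y z j)))))) ⟩
        mod3 (χ (b new₂) + (χ (b new₂) + (χ (b new₂) + BR.size y z)))               ≡⟨ mod3-triple (b new₂) (BR.size y z) ⟩
        mod3 (BR.size y z)                                                          ∎
        where
        open ≡-Reasoning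
        b : Fin (3 + m) → Bool
        b = BG.branch (old y) (old z)
        b₀≡b₂ : b new₀ ≡ b new₂
        b₀≡b₂ = proj₁ (new-together y z)
        b₁≡b₂ : b new₁ ≡ b new₂
        b₁≡b₂ = proj₂ (new-together y z)

      fewBad-rest : (∀ y → BG.FewBad y) → ∀ y → BR.FewBad y
      fewBad-rest few y = ≤-trans (subst (count (BR.badNeighbour y) ≤_) (sym (sum-permute (λ v → χ (bn v)) π)) (≤-trans (count-mono _ _ bad-old) drop-new)) (few (old y))
        where
        bn : Fin (3 + m) → Bool
        bn = BG.badNeighbour (old y)
        bad-old : ∀ j → T (BR.badNeighbour y j) → T (bn (old j))
        bad-old j t = T∧ (T∧₁ t) (BG.bad⁺ (λ r → BR.bad⁻ (T∧₂ {adj rest y j} t) (trans (sym (mod3-size-rest y j)) r)))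
        drop-new : count (λ j → bn (old j)) ≤ χ (bn new₀) + (χ (bn new₁) + (χ (bn new₂) + count (λ j → bn (old j))))
        drop-new = ≤-trans (m≤n+m _ (χ (bn new₂))) (≤-trans (m≤n+m _ (χ (bn new₁))) (m≤n+m _ (χ (bn new₀))))

record Reduction {m} (G : Graph (3 + suc m)) : Set where
  field
    G' : Graph (suc m)
    tree : IsTree G'
    fewBad : ∀ y → Branches.FewBad G' tree y
    x : Fin (suc m)
    ≅G : O1 G' x ≅ G ⊎ O2 G' x ≅ G

module _ {m} (G : Graph (3 + suc m)) (tr : IsTree G) (few : ∀ y → Branches.FewBad G tr y) where

  private
    1≤suc : 1 ≤ suc m
    1≤suc = s≤s z≤n

  reduce-O1 : O1Shape G → Reduction G
  reduce-O1 d = record { G' = rest ; tree = rest-tree 1≤suc ; fewBad = fewBad-rest 1≤suc few ; x = x ; ≅G = inj₁ (O1-rest≅ e₀₁ e₁₂ ¬e₀₂) }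
    where
    open O1Shape d
    module F = ToFront u v w (adj⇒≢ G uv) u≢w (adj⇒≢ G vw)
    open Relabel G tr F.π
    x-cover : ∃ λ j → old j ≡ p
    x-cover = old-cover p (λ e → u≢p (trans (sym F.π0) (sym e))) (λ e → v≢p (trans (sym F.π1) (sym e))) (λ e → adj⇒≢ G wp (trans (sym F.π2) (sym e)))
    x : Fin (suc m)
    x = proj₁ x-cover
    old-x : old x ≡ p
    old-x = proj₂ x-cover
    e₀₁ : Adj G new₀ new₁
    e₀₁ = adj-subst G (sym F.π0) (sym F.π1) uv
    e₁₂ : Adj G new₁ new₂
    e₁₂ = adj-subst G (sym F.π1) (sym F.π2) vw
    ¬e₀₂ : ¬ Adj G new₀ new₂
    ¬e₀₂ e = adj⇒≢ G vw (sym (Nu w (adj-subst G F.π0 F.π2 e)))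
    new₀-inside : ∀ j → ¬ Adj G new₀ (old j)
    new₀-inside j e = old≢new₁ j (trans (Nu (old j) (adj-subst G F.π0 refl e)) (sym F.π1))
    new₁-inside : ∀ j → ¬ Adj G new₁ (old j)
    new₁-inside j e with Nv (old j) (adj-subst G F.π1 refl e)
    ... | inj₁ q = old≢new₀ j (trans q (sym F.π0))
    ... | inj₂ q = old≢new₂ j (trans q (sym F.π2))
    new₂-attached : ∀ j → Adj G new₂ (old j) → j ≡ x
    new₂-attached j e with Nw (old j) (adj-subst G F.π2 refl e)
    ... | inj₁ q = ⊥-elim (old≢new₁ j (trans q (sym F.π1)))
    ... | inj₂ q = old-injective (trans q (sym old-x))
    open Pendant x new₀-inside new₁-inside new₂-attached (adj-subst G (sym F.π2) (sym old-x) wp)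
      (move (T-not ¬isOld-new₀) e₀₁ (move (T-not ¬isOld-new₁) e₁₂ (stop (T-not ¬isOld-new₂))))
      (move (T-not ¬isOld-new₁) e₁₂ (stop (T-not ¬isOld-new₂)))

  reduce-O2 : O2Shape G → Reduction G
  reduce-O2 d = record { G' = rest ; tree = rest-tree 1≤suc ; fewBad = fewBad-rest 1≤suc few ; x = x ; ≅G = inj₂ (O2-rest≅ ¬e₀₁ e₀₂ e₁₂) }
    where
    open O2Shape d
    module F = ToFront u u' v u≢u' (adj⇒≢ G uv) (adj⇒≢ G u'v)
    open Relabel G tr F.π
    x-cover : ∃ λ j → old j ≡ p
    x-cover = old-cover p (λ e → u≢p (trans (sym F.π0) (sym e))) (λ e → u'≢p (trans (sym F.π1) (sym e))) (λ e → adj⇒≢ G vp (trans (sym F.π2) (sym e)))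
    x : Fin (suc m)
    x = proj₁ x-cover
    old-x : old x ≡ p
    old-x = proj₂ x-cover
    e₀₂ : Adj G new₀ new₂
    e₀₂ = adj-subst G (sym F.π0) (sym F.π2) uv
    e₁₂ : Adj G new₁ new₂
    e₁₂ = adj-subst G (sym F.π1) (sym F.π2) u'v
    ¬e₀₁ : ¬ Adj G new₀ new₁
    ¬e₀₁ e = adj⇒≢ G u'v (Nu u' (adj-subst G F.π0 F.π1 e))
    new₀-inside : ∀ j → ¬ Adj G new₀ (old j)
    new₀-inside j e = old≢new₂ j (trans (Nu (old j) (adj-subst G F.π0 refl e)) (sym F.π2))
    new₁-inside : ∀ j → ¬ Adj G new₁ (old j)
    new₁-inside j e = old≢new₂ j (trans (Nu' (old j) (adj-subst G F.π1 refl e)) (sym F.π2))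
    new₂-attached : ∀ j → Adj G new₂ (old j) → j ≡ x
    new₂-attached j e with Nv (old j) (adj-subst G F.π2 refl e)
    ... | inj₁ q = ⊥-elim (old≢new₀ j (trans q (sym F.π0)))
    ... | inj₂ (inj₁ q) = ⊥-elim (old≢new₁ j (trans q (sym F.π1)))
    ... | inj₂ (inj₂ q) = old-injective (trans q (sym old-x))
    open Pendant x new₀-inside new₁-inside new₂-attached (adj-subst G (sym F.π2) (sym old-x) vp)
      (move (T-not ¬isOld-new₀) e₀₂ (stop (T-not ¬isOld-new₂)))
      (move (T-not ¬isOld-new₁) e₁₂ (stop (T-not ¬isOld-new₂)))

P3≅ : ∀ (G : Graph 3) u v w → Adj G u v → Adj G v w → ¬ Adj G u w → u ≢ w → P3 ≅ G
P3≅ G u v w uv vw ¬uw u≢w = record { bij = F.π ; pres = pres }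
  where
  module F = ToFront {0} u v w (adj⇒≢ G uv) u≢w (adj⇒≢ G vw)
  adj≡true : ∀ {a b} → Adj G a b → true ≡ adj G a b
  adj≡true e = sym (T⇒≡true e)
  adj≡false : ∀ {a b} → ¬ Adj G a b → false ≡ adj G a b
  adj≡false ne = sym (¬T⇒≡false ne)
  e₀₁ : Adj G (F.π ⟨$⟩ʳ zero) (F.π ⟨$⟩ʳ suc zero)
  e₀₁ = adj-subst G (sym F.π0) (sym F.π1) uv
  e₁₂ : Adj G (F.π ⟨$⟩ʳ suc zero) (F.π ⟨$⟩ʳ suc (suc zero))
  e₁₂ = adj-subst G (sym F.π1) (sym F.π2) vw
  ¬e₀₂ : ¬ Adj G (F.π ⟨$⟩ʳ zero) (F.π ⟨$⟩ʳ suc (suc zero))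
  ¬e₀₂ e = ¬uw (adj-subst G F.π0 F.π2 e)
  pres : ∀ i j → p3adj i j ≡ adj G (F.π ⟨$⟩ʳ i) (F.π ⟨$⟩ʳ j)
  pres zero zero = sym (irrefl G _)
  pres zero (suc zero) = adj≡true e₀₁
  pres zero (suc (suc zero)) = adj≡false ¬e₀₂
  pres (suc zero) zero = adj≡true (adj-sym G e₀₁)
  pres (suc zero) (suc zero) = sym (irrefl G _)
  pres (suc zero) (suc (suc zero)) = adj≡true e₁₂
  pres (suc (suc zero)) zero = adj≡false (λ e → ¬e₀₂ (adj-sym G e))
  pres (suc (suc zero)) (suc zero) = adj≡true (adj-sym G e₁₂)
  pres (suc (suc zero)) (suc (suc zero)) = sym (irrefl G _)

isolated : ∀ {n} (G : Graph n) k l → k ≢ l → Walk G k l → ¬ (∀ b → ¬ Adj G k b)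
isolated G k l ne here _ = ne refl
isolated G k l ne (step e w) none = none _ e

tree₃∈𝒯 : ∀ (G : Graph 3) → IsTree G → InT G
tree₃∈𝒯 G tr with adj G 0F 1F in e₀₁ | adj G 0F 2F in e₀₂ | adj G 1F 2F in e₁₂
... | true | true | true = ⊥-elim (IsTree.acyclic tr triangle)
  where
  triangle : Cycle G
  triangle = record { m = 0 ; vtx = λ i → i ; inj = λ e → e ; edges = edges ; close = adj-sym G (≡true⇒T e₀₂) }
    where
    edges : ∀ (i : Fin 2) → Adj G (Data.Fin.inject₁ i) (suc i)
    edges zero = ≡true⇒T e₀₁
    edges (suc zero) = ≡true⇒T e₁₂
... | true | true | false = iso base (P3≅ G 1F 0F 2F (adj-sym G (≡true⇒T e₀₁)) (≡true⇒T e₀₂) (≡false⇒¬T e₁₂) (λ ()))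
... | true | false | true = iso base (P3≅ G 0F 1F 2F (≡true⇒T e₀₁) (≡true⇒T e₁₂) (≡false⇒¬T e₀₂) (λ ()))
... | false | true | true = iso base (P3≅ G 0F 2F 1F (≡true⇒T e₀₂) (adj-sym G (≡true⇒T e₁₂)) (≡false⇒¬T e₀₁) (λ ()))
... | false | false | _ = ⊥-elim (isolated G 0F 1F (λ ()) (IsTree.connected tr 0F 1F) λ { zero → adj-irrefl G ; (suc zero) → ≡false⇒¬T e₀₁ ; (suc (suc zero)) → ≡false⇒¬T e₀₂ })
... | true | false | false = ⊥-elim (isolated G 2F 0F (λ ()) (IsTree.connected tr 2F 0F) λ { zero t → ≡false⇒¬T e₀₂ (adj-sym G t) ; (suc zero) t → ≡false⇒¬T e₁₂ (adj-sym G t) ; (suc (suc zero)) → adj-irrefl G })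
... | false | true | false = ⊥-elim (isolated G 1F 0F (λ ()) (IsTree.connected tr 1F 0F) λ { zero t → ≡false⇒¬T e₀₁ (adj-sym G t) ; (suc zero) → adj-irrefl G ; (suc (suc zero)) → ≡false⇒¬T e₁₂ })

fewBad⇒InT : ∀ m (G : Graph (3 + m)) (tr : IsTree G) → mod3 m ≡ 0 → (∀ y → Branches.FewBad G tr y) → InT G
fewBad⇒InT zero G tr _ _ = tree₃∈𝒯 G tr
fewBad⇒InT (suc (suc (suc m))) G tr r few with Descent.size3-branch G tr r few zero (λ ())
... | p , q , e , s≡3 = rebuild ([ reduce-O1 G tr few , reduce-O2 G tr few ]′ (Descent.size3-shape G tr r few e s≡3))
  where
  rebuild : Reduction G → InT G
  rebuild red with Reduction.≅G red
  ... | inj₁ i = iso (op1 (fewBad⇒InT m (Reduction.G' red) (Reduction.tree red) r (Reduction.fewBad red)) (Reduction.x red)) i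
  ... | inj₂ i = iso (op2 (fewBad⇒InT m (Reduction.G' red) (Reduction.tree red) r (Reduction.fewBad red)) (Reduction.x red)) i

fewBad⇒InT′ : ∀ {n} (G : Graph n) (tr : IsTree G) → mod3 n ≡ 0 → (∀ y → Branches.FewBad G tr y) → InT G
fewBad⇒InT′ {zero} G tr _ _ with IsTree.nonempty tr
... | ()
fewBad⇒InT′ {suc (suc (suc m))} G tr = fewBad⇒InT m G tr

theorem2 : ∀ {n : ℕ} (T : Graph n) → IsTree T →
    ((∃ λ k → IsDissNumber T k × 3 * k ≡ 2 * n) ⇔ InT T) ×
    (InT T ⇔ (3 ∣ n × (∀ (y : Fin n) → AtMostTwoBadComponents T y)))
theorem2 {n} T tr = mk⇔ (c⇒b ∘ a⇒c) b⇒a , mk⇔ (a⇒c ∘ b⇒a) c⇒b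
  where
  open Branches T tr
  b⇒a : InT T → ∃ λ k → IsDissNumber T k × 3 * k ≡ 2 * n
  b⇒a t = twoThirds⇒diss {G = T} (InT⇒twoThirds t)
  a⇒c : (∃ λ k → IsDissNumber T k × 3 * k ≡ 2 * n) → 3 ∣ n × (∀ y → AtMostTwoBadComponents T y)
  a⇒c (k , dn , e) = mod3≡0⇒∣ n (mod3-2*≡0 n (trans (cong mod3 (sym e)) (mod3-3* k))) ,
                     λ y → fewBad⇒atMostTwoBad y (Dissociations.twoThirds⇒fewBad T tr dn e y)
  c⇒b : 3 ∣ n × (∀ y → AtMostTwoBadComponents T y) → InT T
  c⇒b (3∣n , h) = fewBad⇒InT′ T tr (∣⇒mod3≡0 3∣n) (λ y → atMostTwoBad⇒fewBad y (h y))
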